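{- Let $\mathbb{F}_q$ be a finite field and let $S_d$ be the set of all homogeneous polynomials $F(X,Y,Z)\in\mathbb{F}_q[X,Y,Z]$ of degree $d$ (including $0$, i.e. the $\mathbb{F}_q$-vector space of degree-$d$ forms), and for $F\in S_d$ let $C_F(\mathbb{F}_q)=\{P\in\mathbb{P}^2(\mathbb{F}_q): F(P)=0\}$. Let $Y_1,\dots,Y_{q^2+q+1}$ be i.i.d. random variables taking the value $1$ with probability $1/q$ and $0$ with probability $(q-1)/q$. Then for $d>q^2+q+1$ and every integer $t$, \[ \frac{\#\{F\in S_d: \#C_F(\mathbb{F}_q)=t\}}{\#S_d}=\mathrm{Prob}\left(Y_1+\dots+Y_{q^2+q+1}=t\right). \] -}

module Defs where

open import Data.Nat as ℕ using (ℕ; zero; suc; _∸_)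
open import Data.Fin as Fin using (Fin)
open import Data.Bool using (Bool; true; false)
open import Data.List as List using (List; []; _∷_; _++_; map; concatMap; length; filter; upTo; allFin; zipWith; foldr)
open import Data.Vec as Vec using (Vec; []; _∷_; toList)
open import Data.Product using (_×_; _,_; ∃)
open import Data.Integer as ℤ using (ℤ; +_)
open import Data.Rational as ℚ using (ℚ; _/_)
open import Relation.Binary.PropositionalEquality using (_≡_; _≢_)
open import Algebra.Structures using (IsCommutativeRing)

-- A finite field with q elements, realised (up to isomorphism) on the carrier Fin q,
-- with propositional equality.
record FiniteField : Set where
  infixl 6 _+_
  infixl 7 _*_
  field
    q          : ℕ
    _+_ _*_    : Fin q → Fin q → Fin q
    -_         : Fin q → Fin q
    0# 1#      : Fin q
    isCommRing : IsCommutativeRing _≡_ _+_ _*_ -_ 0# 1#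
    0≢1        : 0# ≢ 1#
    inverse    : ∀ x → x ≢ 0# → ∃ λ y → x * y ≡ 1#

allVecs : {A : Set} → List A → (n : ℕ) → List (Vec A n)
allVecs xs zero    = [] ∷ []
allVecs xs (suc n) = concatMap (λ x → map (x ∷_) (allVecs xs n)) xs

-- exponent triples (a , b , c) with a + b + c = d: the monomials X^a Y^b Z^c of degree d
monomials : ℕ → List (ℕ × ℕ × ℕ)
monomials d = concatMap (λ a → map (λ b → (a , b , d ∸ a ∸ b)) (upTo (suc (d ∸ a)))) (upTo (suc d))

module _ (𝔽 : FiniteField) where
  open FiniteField 𝔽

  Elt : Set
  Elt = Fin q

  pow : Elt → ℕ → Elt
  pow x zero    = 1#
  pow x (suc n) = x * pow x n

  -- a degree-d form = its vector of coefficients, one per monomial of degree d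
  Form : ℕ → Set
  Form d = Vec Elt (length (monomials d))

  S : (d : ℕ) → List (Form d)
  S d = allVecs (allFin q) (length (monomials d))

  eval : {d : ℕ} → Form d → Elt × Elt × Elt → Elt
  eval {d} F (x , y , z) =
    foldr _+_ 0# (zipWith (λ c m → mon c m) (toList F) (monomials d))
    where
    mon : Elt → ℕ × ℕ × ℕ → Elt
    mon c (a , b , e) = c * pow x a * pow y b * pow z e

  -- P^2(F_q), one normalised representative per point:
  -- (1:y:z), (0:1:z), (0:0:1)
  P2 : List (Elt × Elt × Elt)
  P2 = concatMap (λ y → map (λ z → (1# , y , z)) (allFin q)) (allFin q)
       ++ map (λ z → (0# , 1# , z)) (allFin q)
       ++ ((0# , 0# , 1#) ∷ [])

  #C : (d : ℕ) → Form d → ℕ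
  #C d F = length (filter (λ P → eval {d} F P Fin.≟ 0#) P2)

  countWith : (d : ℕ) → ℤ → ℕ
  countWith d t = length (filter (λ F → (+ #C d F) ℤ.≟ t) (S d))

  #S : ℕ → ℕ
  #S d = length (S d)

-- n / m in ℚ (m = 0 gives 0; never used with m = 0 below since q ≥ 2)
frac : ℤ → ℕ → ℚ
frac n zero    = ℚ.0ℚ
frac n (suc m) = n / suc m

-- Probability that Y_1 + ... + Y_n = t, where Y_i are i.i.d. with
-- P(Y_i = 1) = p1, P(Y_i = 0) = p0: sum over all outcomes in {0,1}^n of the product weight.
bitsSum : {n : ℕ} → Vec Bool n → ℕ
bitsSum []           = 0
bitsSum (true ∷ v)   = suc (bitsSum v)
bitsSum (false ∷ v)  = bitsSum v

weight : (p0 p1 : ℚ) → {n : ℕ} → Vec Bool n → ℚ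
weight p0 p1 []          = ℚ.1ℚ
weight p0 p1 (true ∷ v)  = p1 ℚ.* weight p0 p1 v
weight p0 p1 (false ∷ v) = p0 ℚ.* weight p0 p1 v

probSum : (p0 p1 : ℚ) → (n : ℕ) → ℤ → ℚ
probSum p0 p1 n t =
  foldr ℚ._+_ ℚ.0ℚ (map (weight p0 p1) (filter (λ v → (+ bitsSum v) ℤ.≟ t) (allVecs (false ∷ true ∷ []) n)))

module Submission where

-- For d ≥ 2q + 1 the evaluation map F ↦ (F(P))_P from S_d to 𝔽_q^N, N = #ℙ²(𝔽_q) = q² + q + 1,
-- is linear and onto: for each rational point u, some product of d linear forms vanishes at
-- every rational point except u. Hence all fibres of this map have the same size, so #C_F is
-- distributed like the number of zero coordinates of a uniformly random vector of 𝔽_q^N, whose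
-- coordinates vanish independently with probability 1/q.

open import Defs

module Counting where

  open import Data.Nat using (ℕ; zero; suc; _+_; _*_; _^_; _≤_)
  open import Data.Nat.Properties
  open import Data.Empty using (⊥-elim)
  open import Data.Fin as Fin using (Fin)
  import Data.Fin.Properties as Fin
  open import Data.List using (List; []; _∷_; _++_; map; concatMap; length; filter; allFin)
  import Data.List.Properties as List
  open import Data.List.Relation.Unary.All using (All; []; _∷_)
  open import Data.List.Relation.Unary.AllPairs using ([]; _∷_)
  open import Data.List.Relation.Unary.Unique.Propositional using (Unique)
  open import Data.Product using (uncurry)
  open import Data.Vec using (Vec; []; _∷_)
  import Data.Vec.Properties as Vec
  open import Function using (_∘_)
  open import Relation.Binary.Definitions using (DecidableEquality)
  open import Relation.Binary.PropositionalEquality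
  open import Relation.Nullary using (Dec; yes; no; ¬_; _×-dec_)
  open import Relation.Unary using (Pred; Decidable)
  open import Algebra.Properties.CommutativeSemigroup +-commutativeSemigroup using () renaming (interchange to +-interchange)

  ∑ : {A : Set} → (A → ℕ) → List A → ℕ
  ∑ f []       = 0
  ∑ f (x ∷ xs) = f x + ∑ f xs

  χ : {P : Set} → Dec P → ℕ
  χ (yes _) = 1
  χ (no _)  = 0

  χ-cong : {P Q : Set} → (P → Q) → (Q → P) → (p? : Dec P) (q? : Dec Q) → χ p? ≡ χ q?
  χ-cong f g (yes p) (yes q) = refl
  χ-cong f g (yes p) (no ¬q) = ⊥-elim (¬q (f p))
  χ-cong f g (no ¬p) (yes q) = ⊥-elim (¬p (g q))
  χ-cong f g (no ¬p) (no ¬q) = refl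

  χ-× : {P Q : Set} (p? : Dec P) (q? : Dec Q) → χ (p? ×-dec q?) ≡ χ p? * χ q?
  χ-× (yes _) (yes _) = refl
  χ-× (yes _) (no _)  = refl
  χ-× (no _)  _       = refl

  χ-yes : {P : Set} (p? : Dec P) → P → χ p? ≡ 1
  χ-yes (yes _) p = refl
  χ-yes (no ¬p) p = ⊥-elim (¬p p)

  χ-no : {P : Set} (p? : Dec P) → ¬ P → χ p? ≡ 0
  χ-no (yes p) ¬p = ⊥-elim (¬p p)
  χ-no (no _)  _  = refl

  module _ {A : Set} where

    length-filter≡∑χ : {P : Pred A _} (P? : Decidable P) (xs : List A) →
                       length (filter P? xs) ≡ ∑ (χ ∘ P?) xs
    length-filter≡∑χ P? []       = refl
    length-filter≡∑χ P? (x ∷ xs) with P? x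
    ... | yes _ = cong suc (length-filter≡∑χ P? xs)
    ... | no _  = length-filter≡∑χ P? xs

    ∑-++ : (f : A → ℕ) (xs ys : List A) → ∑ f (xs ++ ys) ≡ ∑ f xs + ∑ f ys
    ∑-++ f []       ys = refl
    ∑-++ f (x ∷ xs) ys = trans (cong (f x +_) (∑-++ f xs ys)) (sym (+-assoc (f x) _ _))

    ∑-cong : {f g : A → ℕ} → (∀ x → f x ≡ g x) → (xs : List A) → ∑ f xs ≡ ∑ g xs
    ∑-cong f≗g []       = refl
    ∑-cong f≗g (x ∷ xs) = cong₂ _+_ (f≗g x) (∑-cong f≗g xs)

    ∑-0 : {f : A → ℕ} → (∀ x → f x ≡ 0) → (xs : List A) → ∑ f xs ≡ 0
    ∑-0 f≗0 []       = refl
    ∑-0 f≗0 (x ∷ xs) = cong₂ _+_ (f≗0 x) (∑-0 f≗0 xs)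

    ∑-+ : (f g : A → ℕ) (xs : List A) → ∑ (λ x → f x + g x) xs ≡ ∑ f xs + ∑ g xs
    ∑-+ f g []       = refl
    ∑-+ f g (x ∷ xs) = trans (cong (f x + g x +_) (∑-+ f g xs)) (+-interchange (f x) (g x) (∑ f xs) (∑ g xs))

    ∑-*ˡ : (k : ℕ) (f : A → ℕ) (xs : List A) → ∑ (λ x → k * f x) xs ≡ k * ∑ f xs
    ∑-*ˡ k f []       = sym (*-zeroʳ k)
    ∑-*ˡ k f (x ∷ xs) = trans (cong (k * f x +_) (∑-*ˡ k f xs)) (sym (*-distribˡ-+ k (f x) (∑ f xs)))

    ∑-*ʳ : (k : ℕ) (f : A → ℕ) (xs : List A) → ∑ (λ x → f x * k) xs ≡ ∑ f xs * k
    ∑-*ʳ k f xs = trans (∑-cong (λ x → *-comm (f x) k) xs) (trans (∑-*ˡ k f xs) (*-comm k _))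

    ∑-const : (k : ℕ) (xs : List A) → ∑ (λ _ → k) xs ≡ length xs * k
    ∑-const k []       = refl
    ∑-const k (x ∷ xs) = cong (k +_) (∑-const k xs)

  module _ {A B : Set} where

    ∑-map : (f : B → ℕ) (g : A → B) (xs : List A) → ∑ f (map g xs) ≡ ∑ (f ∘ g) xs
    ∑-map f g []       = refl
    ∑-map f g (x ∷ xs) = cong (f (g x) +_) (∑-map f g xs)

    ∑-concatMap : (f : B → ℕ) (g : A → List B) (xs : List A) →
                  ∑ f (concatMap g xs) ≡ ∑ (λ x → ∑ f (g x)) xs
    ∑-concatMap f g []       = refl
    ∑-concatMap f g (x ∷ xs) = trans (∑-++ f (g x) (concatMap g xs)) (cong (∑ f (g x) +_) (∑-concatMap f g xs))

    ∑-swap : (f : A → B → ℕ) (xs : List A) (ys : List B) →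
             ∑ (λ x → ∑ (f x) ys) xs ≡ ∑ (λ y → ∑ (λ x → f x y) xs) ys
    ∑-swap f []       ys = sym (∑-0 (λ _ → refl) ys)
    ∑-swap f (x ∷ xs) ys = trans (cong (∑ (f x) ys +_) (∑-swap f xs ys)) (sym (∑-+ (f x) _ ys))

  module Enumeration {A : Set} (_≟_ : DecidableEquality A) where

    IsEnumeration : List A → Set
    IsEnumeration xs = ∀ a → ∑ (λ x → χ (a ≟ x)) xs ≡ 1

    ∑-pick : (xs : List A) → IsEnumeration xs → (a : A) (f : A → ℕ) →
             ∑ (λ x → χ (a ≟ x) * f x) xs ≡ f a
    ∑-pick xs enum a f = begin
        ∑ (λ x → χ (a ≟ x) * f x) xs  ≡⟨ ∑-cong χ*f≡χ*fa xs ⟩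
        ∑ (λ x → χ (a ≟ x) * f a) xs  ≡⟨ ∑-*ʳ (f a) _ xs ⟩
        ∑ (λ x → χ (a ≟ x)) xs * f a  ≡⟨ cong (_* f a) (enum a) ⟩
        1 * f a                       ≡⟨ *-identityˡ (f a) ⟩
        f a                           ∎
      where
      open ≡-Reasoning
      χ*f≡χ*fa : ∀ x → χ (a ≟ x) * f x ≡ χ (a ≟ x) * f a
      χ*f≡χ*fa x with a ≟ x
      ... | yes refl = refl
      ... | no _     = refl

    ∑-fibres : {B : Set} (xs : List B) (ys : List A) → IsEnumeration ys → (e : B → A) (h : A → ℕ) →
               ∑ (h ∘ e) xs ≡ ∑ (λ y → ∑ (λ x → χ (e x ≟ y)) xs * h y) ys
    ∑-fibres xs ys enum e h = begin
        ∑ (h ∘ e) xs                                  ≡⟨ ∑-cong (λ x → sym (∑-pick ys enum (e x) h)) xs ⟩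
        ∑ (λ x → ∑ (λ y → χ (e x ≟ y) * h y) ys) xs  ≡⟨ ∑-swap _ xs ys ⟩
        ∑ (λ y → ∑ (λ x → χ (e x ≟ y) * h y) xs) ys  ≡⟨ ∑-cong (λ y → ∑-*ʳ (h y) _ xs) ys ⟩
        ∑ (λ y → ∑ (λ x → χ (e x ≟ y)) xs * h y) ys  ∎
      where open ≡-Reasoning

    ∑-bijection : (xs : List A) → IsEnumeration xs → (τ ρ : A → A) →
                  (∀ x → ρ (τ x) ≡ x) → (∀ y → τ (ρ y) ≡ y) →
                  (f : A → ℕ) → ∑ (f ∘ τ) xs ≡ ∑ f xs
    ∑-bijection xs enum τ ρ ρτ τρ f = begin
        ∑ (f ∘ τ) xs                                ≡⟨ ∑-fibres xs xs enum τ f ⟩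
        ∑ (λ y → ∑ (λ x → χ (τ x ≟ y)) xs * f y) xs ≡⟨ ∑-cong (λ y → cong (_* f y) (fibre≡1 y)) xs ⟩
        ∑ (λ y → 1 * f y) xs                        ≡⟨ ∑-cong (λ y → *-identityˡ (f y)) xs ⟩
        ∑ f xs                                      ∎
      where
      open ≡-Reasoning
      fibre≡1 : ∀ y → ∑ (λ x → χ (τ x ≟ y)) xs ≡ 1
      fibre≡1 y = trans (∑-cong (λ x → χ-cong (λ τx≡y → trans (sym (cong ρ τx≡y)) (ρτ x))
                                               (λ ρy≡x → trans (sym (cong τ ρy≡x)) (τρ y))
                                               (τ x ≟ y) (ρ y ≟ x)) xs)
                        (enum (ρ y))

    ∑-split : (xs : List A) → IsEnumeration xs → (a : A) (g : ℕ → ℕ) →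
              ∑ (λ x → g (χ (x ≟ a))) xs + g 0 ≡ g 1 + length xs * g 0
    ∑-split xs enum a g = begin
        ∑ (λ x → g (χ (x ≟ a))) xs + g 0
          ≡⟨ cong (∑ (λ x → g (χ (x ≟ a))) xs +_) (∑-pick xs enum a (λ _ → g 0)) ⟨
        ∑ (λ x → g (χ (x ≟ a))) xs + ∑ (λ x → χ (a ≟ x) * g 0) xs
          ≡⟨ ∑-+ _ _ xs ⟨
        ∑ (λ x → g (χ (x ≟ a)) + χ (a ≟ x) * g 0) xs
          ≡⟨ ∑-cong (λ x → pointwise (x ≟ a) (a ≟ x)) xs ⟩
        ∑ (λ x → χ (a ≟ x) * g 1 + g 0) xs
          ≡⟨ ∑-+ _ _ xs ⟩
        ∑ (λ x → χ (a ≟ x) * g 1) xs + ∑ (λ _ → g 0) xs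
          ≡⟨ cong₂ _+_ (∑-pick xs enum a (λ _ → g 1)) (∑-const (g 0) xs) ⟩
        g 1 + length xs * g 0 ∎
      where
      open ≡-Reasoning
      pointwise : ∀ {x} (x≟a : Dec (x ≡ a)) (a≟x : Dec (a ≡ x)) → g (χ x≟a) + χ a≟x * g 0 ≡ χ a≟x * g 1 + g 0
      pointwise (yes _)   (yes _)   = cong₂ _+_ (sym (+-identityʳ (g 1))) (+-identityʳ (g 0))
      pointwise (no _)    (no _)    = +-identityʳ (g 0)
      pointwise (yes x≡a) (no a≢x)  = ⊥-elim (a≢x (sym x≡a))
      pointwise (no x≢a)  (yes a≡x) = ⊥-elim (x≢a (sym a≡x))

    ∑χ≡0⇒All≢ : {a : A} (xs : List A) → ∑ (λ x → χ (a ≟ x)) xs ≡ 0 → All (a ≢_) xs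
    ∑χ≡0⇒All≢     []       _     = []
    ∑χ≡0⇒All≢ {a} (x ∷ xs) count≡0 =
      (λ a≡x → 1≢0 (trans (sym (χ-yes (a ≟ x) a≡x)) (m+n≡0⇒m≡0 _ count≡0)))
      ∷ ∑χ≡0⇒All≢ xs (m+n≡0⇒n≡0 (χ (a ≟ x)) count≡0)
      where
      1≢0 : 1 ≢ 0
      1≢0 ()

    ∑χ≤1⇒Unique : (xs : List A) → (∀ a → ∑ (λ x → χ (a ≟ x)) xs ≤ 1) → Unique xs
    ∑χ≤1⇒Unique []       _        = []
    ∑χ≤1⇒Unique (x ∷ xs) count≤1 =
      ∑χ≡0⇒All≢ xs x∉xs ∷ ∑χ≤1⇒Unique xs (λ a → ≤-trans (m≤n+m _ (χ (a ≟ x))) (count≤1 a))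
      where
      x∉xs : ∑ (λ y → χ (x ≟ y)) xs ≡ 0
      x∉xs = n≤0⇒n≡0 (+-cancelˡ-≤ 1 _ 0 (subst (λ c → c + ∑ (λ y → χ (x ≟ y)) xs ≤ 1) (χ-yes (x ≟ x) refl) (count≤1 x)))

    isEnumeration⇒Unique : (xs : List A) → IsEnumeration xs → Unique xs
    isEnumeration⇒Unique xs enum = ∑χ≤1⇒Unique xs (≤-reflexive ∘ enum)

  open Enumeration public

  allFin-isEnumeration : (n : ℕ) → IsEnumeration Fin._≟_ (allFin n)
  allFin-isEnumeration (suc n) a = begin
      ∑ (λ x → χ (a Fin.≟ x)) (allFin (suc n))
        ≡⟨ cong (λ ys → ∑ (λ x → χ (a Fin.≟ x)) (Fin.zero ∷ ys)) (sym (List.map-tabulate (λ i → i) Fin.suc)) ⟩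
      χ (a Fin.≟ Fin.zero) + ∑ (λ x → χ (a Fin.≟ x)) (map Fin.suc (allFin n))
        ≡⟨ cong (χ (a Fin.≟ Fin.zero) +_) (∑-map _ Fin.suc (allFin n)) ⟩
      χ (a Fin.≟ Fin.zero) + ∑ (λ x → χ (a Fin.≟ Fin.suc x)) (allFin n)
        ≡⟨ count a ⟩
      1 ∎
    where
    open ≡-Reasoning
    count : ∀ a → χ (a Fin.≟ Fin.zero) + ∑ (λ x → χ (a Fin.≟ Fin.suc x)) (allFin n) ≡ 1
    count Fin.zero    = cong suc (∑-0 (λ x → χ-no (Fin.zero Fin.≟ Fin.suc x) (λ ())) (allFin n))
    count (Fin.suc a) = trans (∑-cong (λ x → χ-cong Fin.suc-injective (cong Fin.suc) _ (a Fin.≟ x)) (allFin n))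
                              (allFin-isEnumeration n a)

  module _ {A : Set} (_≟_ : DecidableEquality A) where

    private
      _≟ᵥ_ : {n : ℕ} → DecidableEquality (Vec A n)
      _≟ᵥ_ = Vec.≡-dec _≟_

    χ-∷ : {n : ℕ} (a x : A) (v u : Vec A n) → χ ((a ∷ v) ≟ᵥ (x ∷ u)) ≡ χ (a ≟ x) * χ (v ≟ᵥ u)
    χ-∷ a x v u = trans (χ-cong Vec.∷-injective (uncurry (cong₂ _∷_)) _ ((a ≟ x) ×-dec (v ≟ᵥ u)))
                        (χ-× (a ≟ x) (v ≟ᵥ u))

    allVecs-isEnumeration : (xs : List A) → IsEnumeration _≟_ xs → (n : ℕ) → IsEnumeration _≟ᵥ_ (allVecs xs n)
    allVecs-isEnumeration xs enum zero    []      = refl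
    allVecs-isEnumeration xs enum (suc n) (a ∷ v) = begin
        ∑ (λ w → χ ((a ∷ v) ≟ᵥ w)) (concatMap (λ x → map (x ∷_) (allVecs xs n)) xs)
          ≡⟨ ∑-concatMap _ _ xs ⟩
        ∑ (λ x → ∑ (λ w → χ ((a ∷ v) ≟ᵥ w)) (map (x ∷_) (allVecs xs n))) xs
          ≡⟨ ∑-cong (λ x → ∑-map _ (x ∷_) (allVecs xs n)) xs ⟩
        ∑ (λ x → ∑ (λ u → χ ((a ∷ v) ≟ᵥ (x ∷ u))) (allVecs xs n)) xs
          ≡⟨ ∑-cong (λ x → ∑-cong (χ-∷ a x v) (allVecs xs n)) xs ⟩
        ∑ (λ x → ∑ (λ u → χ (a ≟ x) * χ (v ≟ᵥ u)) (allVecs xs n)) xs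
          ≡⟨ ∑-cong (λ x → trans (∑-*ˡ (χ (a ≟ x)) _ (allVecs xs n))
                                 (cong (χ (a ≟ x) *_) (allVecs-isEnumeration xs enum n v))) xs ⟩
        ∑ (λ x → χ (a ≟ x) * 1) xs
          ≡⟨ trans (∑-cong (λ x → *-identityʳ _) xs) (enum a) ⟩
        1 ∎
      where open ≡-Reasoning

  length-concatMap : {A B : Set} (g : A → List B) (xs : List A) → length (concatMap g xs) ≡ ∑ (length ∘ g) xs
  length-concatMap g []       = refl
  length-concatMap g (x ∷ xs) = trans (List.length-++ (g x)) (cong (length (g x) +_) (length-concatMap g xs))

  length-allVecs : {A : Set} (xs : List A) (n : ℕ) → length (allVecs xs n) ≡ length xs ^ n
  length-allVecs xs zero    = refl
  length-allVecs xs (suc n) = begin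
      length (concatMap (λ x → map (x ∷_) (allVecs xs n)) xs)  ≡⟨ length-concatMap _ xs ⟩
      ∑ (λ x → length (map (x ∷_) (allVecs xs n))) xs         ≡⟨ ∑-cong (λ x → List.length-map (x ∷_) (allVecs xs n)) xs ⟩
      ∑ (λ _ → length (allVecs xs n)) xs                       ≡⟨ ∑-const _ xs ⟩
      length xs * length (allVecs xs n)                        ≡⟨ cong (length xs *_) (length-allVecs xs n) ⟩
      length xs * length xs ^ n                                ∎
    where open ≡-Reasoning

module Probability where

  open import Data.Nat as ℕ using (ℕ; zero; suc; _^_)
  import Data.Nat.Properties as ℕ
  open import Data.Integer as ℤ using (ℤ; +_)
  import Data.Integer.Properties as ℤ
  open import Data.Integer.Solver using (module +-*-Solver)
  open import Data.Rational as ℚ using (ℚ; 0ℚ)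
  import Data.Rational.Properties as ℚ
  open import Data.Rational.Unnormalised as ℚᵘ using (mkℚᵘ; *≡*)
  import Data.Rational.Unnormalised.Properties as ℚᵘ
  open import Data.Bool using (Bool; true; false)
  open import Data.List using (List; []; _∷_; _++_; map; filter; foldr)
  open import Data.Vec using (Vec; _∷_)
  open import Data.Empty using (⊥-elim)
  open import Function using (_∘_)
  open import Relation.Nullary using (Dec; yes; no)
  open import Relation.Unary using (Pred; Decidable)
  open import Relation.Binary.PropositionalEquality
  open Counting using (χ)

  -- frac (+ a) (suc m) is definitionally fromℚᵘ (mkℚᵘ (+ a) m)
  frac-* : ∀ a m b k → frac (+ a) (suc m) ℚ.* frac (+ b) (suc k) ≡ frac (+ (a ℕ.* b)) (suc m ℕ.* suc k)
  frac-* a m b k = ℚ.toℚᵘ-injective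
      (ℚᵘ.≃-trans (ℚ.toℚᵘ-homo-* (frac (+ a) (suc m)) (frac (+ b) (suc k)))
      (ℚᵘ.≃-trans (ℚᵘ.*-cong (ℚ.toℚᵘ-fromℚᵘ (mkℚᵘ (+ a) m)) (ℚ.toℚᵘ-fromℚᵘ (mkℚᵘ (+ b) k)))
      (ℚᵘ.≃-trans unnormalised (ℚᵘ.≃-sym (ℚ.toℚᵘ-fromℚᵘ (mkℚᵘ (+ (a ℕ.* b)) (k ℕ.+ m ℕ.* suc k)))))))
    where
    unnormalised : mkℚᵘ (+ a) m ℚᵘ.* mkℚᵘ (+ b) k ℚᵘ.≃ mkℚᵘ (+ (a ℕ.* b)) (k ℕ.+ m ℕ.* suc k)
    unnormalised = *≡* (cong (ℤ._* + suc (k ℕ.+ m ℕ.* suc k)) (sym (ℤ.pos-* a b)))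

  frac-+ : ∀ a b k → frac (+ a) (suc k) ℚ.+ frac (+ b) (suc k) ≡ frac (+ (a ℕ.+ b)) (suc k)
  frac-+ a b k = ℚ.toℚᵘ-injective
      (ℚᵘ.≃-trans (ℚ.toℚᵘ-homo-+ (frac (+ a) (suc k)) (frac (+ b) (suc k)))
      (ℚᵘ.≃-trans (ℚᵘ.+-cong (ℚ.toℚᵘ-fromℚᵘ (mkℚᵘ (+ a) k)) (ℚ.toℚᵘ-fromℚᵘ (mkℚᵘ (+ b) k)))
      (ℚᵘ.≃-trans unnormalised (ℚᵘ.≃-sym (ℚ.toℚᵘ-fromℚᵘ (mkℚᵘ (+ (a ℕ.+ b)) k))))))
    where
    open +-*-Solver
    cross : ∀ x y s → (x ℤ.* s ℤ.+ y ℤ.* s) ℤ.* s ≡ (x ℤ.+ y) ℤ.* (s ℤ.* s)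
    cross = solve 3 (λ x y s → (x :* s :+ y :* s) :* s := (x :+ y) :* (s :* s)) refl
    unnormalised : mkℚᵘ (+ a) k ℚᵘ.+ mkℚᵘ (+ b) k ℚᵘ.≃ mkℚᵘ (+ (a ℕ.+ b)) k
    unnormalised = *≡* (trans (cross (+ a) (+ b) (+ suc k)) (cong (+ (a ℕ.+ b) ℤ.*_) (ℤ.pos-* (suc k) (suc k))))

  frac-cancelˡ : ∀ k a b → 0 ℕ.< k → 0 ℕ.< b → frac (+ (k ℕ.* a)) (k ℕ.* b) ≡ frac (+ a) b
  frac-cancelˡ (suc c) a (suc b) _ _ = ℚ.fromℚᵘ-cong {mkℚᵘ (+ (suc c ℕ.* a)) (b ℕ.+ c ℕ.* suc b)} {mkℚᵘ (+ a) b} (*≡* (begin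
        + (suc c ℕ.* a) ℤ.* + suc b     ≡⟨ ℤ.pos-* (suc c ℕ.* a) (suc b) ⟨
        + (suc c ℕ.* a ℕ.* suc b)       ≡⟨ cong +_ (trans (cong (ℕ._* suc b) (ℕ.*-comm (suc c) a)) (ℕ.*-assoc a (suc c) (suc b))) ⟩
        + (a ℕ.* (suc c ℕ.* suc b))     ≡⟨ ℤ.pos-* a (suc c ℕ.* suc b) ⟩
        + a ℤ.* + (suc c ℕ.* suc b)     ∎))
    where open ≡-Reasoning

  +suc≡⇒+≡pred : {k : ℕ} {t : ℤ} → + suc k ≡ t → + k ≡ ℤ.pred t
  +suc≡⇒+≡pred = cong ℤ.pred

  +≡pred⇒+suc≡ : {k : ℕ} {t : ℤ} → + k ≡ ℤ.pred t → + suc k ≡ t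
  +≡pred⇒+suc≡ {t = t} eq = trans (cong ℤ.suc eq) (ℤ.suc-pred t)

  ∑ℚ : {A : Set} → (A → ℚ) → List A → ℚ
  ∑ℚ g []       = 0ℚ
  ∑ℚ g (x ∷ xs) = g x ℚ.+ ∑ℚ g xs

  when : {P : Set} → Dec P → ℚ → ℚ
  when (yes _) r = r
  when (no _)  r = 0ℚ

  when-cong : {P Q : Set} → (P → Q) → (Q → P) → (p? : Dec P) (q? : Dec Q) (r : ℚ) → when p? r ≡ when q? r
  when-cong f g (yes p) (yes q) r = refl
  when-cong f g (yes p) (no ¬q) r = ⊥-elim (¬q (f p))
  when-cong f g (no ¬p) (yes q) r = ⊥-elim (¬p (g q))
  when-cong f g (no ¬p) (no ¬q) r = refl

  when-*ˡ : {P : Set} (p? : Dec P) (k r : ℚ) → when p? (k ℚ.* r) ≡ k ℚ.* when p? r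
  when-*ˡ (yes _) k r = refl
  when-*ˡ (no _)  k r = sym (ℚ.*-zeroʳ k)

  module _ {A : Set} where

    foldr-map-filter : {P : Pred A _} (P? : Decidable P) (g : A → ℚ) (xs : List A) →
                       foldr ℚ._+_ 0ℚ (map g (filter P? xs)) ≡ ∑ℚ (λ x → when (P? x) (g x)) xs
    foldr-map-filter P? g []       = refl
    foldr-map-filter P? g (x ∷ xs) with P? x
    ... | yes _ = cong (g x ℚ.+_) (foldr-map-filter P? g xs)
    ... | no _  = trans (foldr-map-filter P? g xs) (sym (ℚ.+-identityˡ _))

    ∑ℚ-++ : (g : A → ℚ) (xs ys : List A) → ∑ℚ g (xs ++ ys) ≡ ∑ℚ g xs ℚ.+ ∑ℚ g ys
    ∑ℚ-++ g []       ys = sym (ℚ.+-identityˡ _)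
    ∑ℚ-++ g (x ∷ xs) ys = trans (cong (g x ℚ.+_) (∑ℚ-++ g xs ys)) (sym (ℚ.+-assoc (g x) _ _))

    ∑ℚ-cong : {g h : A → ℚ} → (∀ x → g x ≡ h x) → (xs : List A) → ∑ℚ g xs ≡ ∑ℚ h xs
    ∑ℚ-cong g≗h []       = refl
    ∑ℚ-cong g≗h (x ∷ xs) = cong₂ ℚ._+_ (g≗h x) (∑ℚ-cong g≗h xs)

    ∑ℚ-*ˡ : (k : ℚ) (g : A → ℚ) (xs : List A) → ∑ℚ (λ x → k ℚ.* g x) xs ≡ k ℚ.* ∑ℚ g xs
    ∑ℚ-*ˡ k g []       = sym (ℚ.*-zeroʳ k)
    ∑ℚ-*ˡ k g (x ∷ xs) = trans (cong (k ℚ.* g x ℚ.+_) (∑ℚ-*ˡ k g xs)) (sym (ℚ.*-distribˡ-+ k (g x) _))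

    ∑ℚ-map : {B : Set} (g : B → ℚ) (f : A → B) (xs : List A) → ∑ℚ g (map f xs) ≡ ∑ℚ (g ∘ f) xs
    ∑ℚ-map g f []       = refl
    ∑ℚ-map g f (x ∷ xs) = cong (g (f x) ℚ.+_) (∑ℚ-map g f xs)

  module _ (p₀ p₁ : ℚ) where

    private
      outcomes : (n : ℕ) → List (Vec Bool n)
      outcomes = allVecs (false ∷ true ∷ [])

      prob : ℕ → ℤ → ℚ
      prob n t = ∑ℚ (λ v → when (+ bitsSum v ℤ.≟ t) (weight p₀ p₁ v)) (outcomes n)

      probSum≡prob : ∀ n t → probSum p₀ p₁ n t ≡ prob n t
      probSum≡prob n t = foldr-map-filter (λ v → + bitsSum v ℤ.≟ t) (weight p₀ p₁) (outcomes n)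

    probSum-suc : ∀ n t → probSum p₀ p₁ (suc n) t ≡ p₀ ℚ.* probSum p₀ p₁ n t ℚ.+ p₁ ℚ.* probSum p₀ p₁ n (ℤ.pred t)
    probSum-suc n t = begin
        probSum p₀ p₁ (suc n) t
          ≡⟨ probSum≡prob (suc n) t ⟩
        ∑ℚ (W t) (map (false ∷_) V ++ map (true ∷_) V ++ [])
          ≡⟨ ∑ℚ-++ (W t) (map (false ∷_) V) _ ⟩
        ∑ℚ (W t) (map (false ∷_) V) ℚ.+ ∑ℚ (W t) (map (true ∷_) V ++ [])
          ≡⟨ cong₂ ℚ._+_ (∑ℚ-map (W t) (false ∷_) V)
                         (trans (∑ℚ-++ (W t) (map (true ∷_) V) []) (trans (ℚ.+-identityʳ _) (∑ℚ-map (W t) (true ∷_) V))) ⟩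
        ∑ℚ (W t ∘ (false ∷_)) V ℚ.+ ∑ℚ (W t ∘ (true ∷_)) V
          ≡⟨ cong₂ ℚ._+_ (∑ℚ-cong (λ v → when-*ˡ (+ bitsSum v ℤ.≟ t) p₀ _) V)
                         (∑ℚ-cong (λ v → trans (when-cong +suc≡⇒+≡pred +≡pred⇒+suc≡
                                                          (+ suc (bitsSum v) ℤ.≟ t) (+ bitsSum v ℤ.≟ ℤ.pred t) _)
                                               (when-*ˡ (+ bitsSum v ℤ.≟ ℤ.pred t) p₁ _)) V) ⟩
        ∑ℚ (λ v → p₀ ℚ.* W t v) V ℚ.+ ∑ℚ (λ v → p₁ ℚ.* W (ℤ.pred t) v) V
          ≡⟨ cong₂ ℚ._+_ (∑ℚ-*ˡ p₀ (W t) V) (∑ℚ-*ˡ p₁ (W (ℤ.pred t)) V) ⟩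
        p₀ ℚ.* ∑ℚ (W t) V ℚ.+ p₁ ℚ.* ∑ℚ (W (ℤ.pred t)) V
          ≡⟨ cong₂ (λ a b → p₀ ℚ.* a ℚ.+ p₁ ℚ.* b) (probSum≡prob n t) (probSum≡prob n (ℤ.pred t)) ⟨
        p₀ ℚ.* probSum p₀ p₁ n t ℚ.+ p₁ ℚ.* probSum p₀ p₁ n (ℤ.pred t) ∎
      where
      open ≡-Reasoning
      V : List (Vec Bool n)
      V = outcomes n
      W : {m : ℕ} → ℤ → Vec Bool m → ℚ
      W t v = when (+ bitsSum v ℤ.≟ t) (weight p₀ p₁ v)

  probSum≡frac : (q′ : ℕ) (A : ℕ → ℤ → ℕ) →
                 (∀ t → A 0 t ≡ χ (+ 0 ℤ.≟ t)) →
                 (∀ n t → A (suc n) t ≡ A n (ℤ.pred t) ℕ.+ q′ ℕ.* A n t) →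
                 ∀ n t → probSum (frac (+ q′) (suc q′)) (frac (+ 1) (suc q′)) n t ≡ frac (+ A n t) (suc q′ ^ n)
  probSum≡frac q′ A A-zero A-suc zero t rewrite A-zero t with + 0 ℤ.≟ t
  ... | yes _ = refl
  ... | no _  = refl
  probSum≡frac q′ A A-zero A-suc (suc n) t = begin
      probSum p₀ p₁ (suc n) t
        ≡⟨ probSum-suc p₀ p₁ n t ⟩
      p₀ ℚ.* probSum p₀ p₁ n t ℚ.+ p₁ ℚ.* probSum p₀ p₁ n (ℤ.pred t)
        ≡⟨ cong₂ (λ a b → p₀ ℚ.* a ℚ.+ p₁ ℚ.* b) (probSum≡frac q′ A A-zero A-suc n t)
                                                   (probSum≡frac q′ A A-zero A-suc n (ℤ.pred t)) ⟩
      p₀ ℚ.* frac (+ A n t) (suc q′ ^ n) ℚ.+ p₁ ℚ.* frac (+ A n (ℤ.pred t)) (suc q′ ^ n)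
        ≡⟨ mix (suc q′ ^ n) (ℕ.m^n>0 (suc q′) n) (A n t) (A n (ℤ.pred t)) ⟩
      frac (+ (q′ ℕ.* A n t ℕ.+ 1 ℕ.* A n (ℤ.pred t))) (suc q′ ^ suc n)
        ≡⟨ cong (λ a → frac (+ a) (suc q′ ^ suc n)) recurrence ⟩
      frac (+ A (suc n) t) (suc q′ ^ suc n) ∎
    where
    open ≡-Reasoning
    p₀ p₁ : ℚ
    p₀ = frac (+ q′) (suc q′)
    p₁ = frac (+ 1) (suc q′)
    mix : ∀ X → 0 ℕ.< X → ∀ a b →
          p₀ ℚ.* frac (+ a) X ℚ.+ p₁ ℚ.* frac (+ b) X ≡ frac (+ (q′ ℕ.* a ℕ.+ 1 ℕ.* b)) (suc q′ ℕ.* X)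
    mix (suc X′) _ a b = trans (cong₂ ℚ._+_ (frac-* q′ q′ a X′) (frac-* 1 q′ b X′)) (frac-+ (q′ ℕ.* a) (1 ℕ.* b) _)
    recurrence : q′ ℕ.* A n t ℕ.+ 1 ℕ.* A n (ℤ.pred t) ≡ A (suc n) t
    recurrence = trans (ℕ.+-comm (q′ ℕ.* A n t) _) (trans (cong (ℕ._+ q′ ℕ.* A n t) (ℕ.*-identityˡ _)) (sym (A-suc n t)))

module Forms (𝔽 : FiniteField) where

  open import Data.Nat as ℕ using (ℕ; zero; suc; _∸_; _<_; z≤n; s≤s)
  import Data.Nat.Properties as ℕ
  open import Data.List using (List; []; _∷_; _++_; map; concatMap; length; applyUpTo; foldr; zipWith)
  open import Data.Vec using (Vec; []; _∷_; toList)
  open import Data.Product using (_×_; _,_; proj₁; proj₂; Σ-syntax)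
  open import Function using (_∘_)
  open import Relation.Binary.PropositionalEquality
  open import Algebra.Bundles using (CommutativeRing)

  open FiniteField 𝔽

  ring : CommutativeRing _ _
  ring = record { isCommutativeRing = isCommRing }

  open CommutativeRing ring
    using (+-assoc; +-identityˡ; +-identityʳ; zeroʳ; distribˡ; +-commutativeSemigroup; commutativeSemiring)
  open import Algebra.Solver.Ring.NaturalCoefficients.Default commutativeSemiring
  open import Algebra.Properties.CommutativeSemigroup +-commutativeSemigroup using (interchange)

  private
    variable
      A B : Set

    E : Set
    E = Elt 𝔽

  Point : Set
  Point = E × E × E

  sumList : (A → E) → List A → E
  sumList g []       = 0#
  sumList g (x ∷ xs) = g x + sumList g xs

  sumUpTo : ℕ → (ℕ → E) → E
  sumUpTo zero    g = 0#
  sumUpTo (suc n) g = g 0 + sumUpTo n (g ∘ suc)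

  sumList-++ : (g : A → E) (xs ys : List A) → sumList g (xs ++ ys) ≡ sumList g xs + sumList g ys
  sumList-++ g []       ys = sym (+-identityˡ _)
  sumList-++ g (x ∷ xs) ys = trans (cong (g x +_) (sumList-++ g xs ys)) (sym (+-assoc _ _ _))

  sumList-map : (g : B → E) (f : A → B) (xs : List A) → sumList g (map f xs) ≡ sumList (g ∘ f) xs
  sumList-map g f []       = refl
  sumList-map g f (x ∷ xs) = cong (g (f x) +_) (sumList-map g f xs)

  sumList-concatMap : (g : B → E) (f : A → List B) (xs : List A) →
                      sumList g (concatMap f xs) ≡ sumList (sumList g ∘ f) xs
  sumList-concatMap g f []       = refl
  sumList-concatMap g f (x ∷ xs) =
    trans (sumList-++ g (f x) (concatMap f xs)) (cong (sumList g (f x) +_) (sumList-concatMap g f xs))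

  sumList-applyUpTo : (g : A → E) (f : ℕ → A) (n : ℕ) → sumList g (applyUpTo f n) ≡ sumUpTo n (g ∘ f)
  sumList-applyUpTo g f zero    = refl
  sumList-applyUpTo g f (suc n) = cong (g (f 0) +_) (sumList-applyUpTo g (f ∘ suc) n)

  sumUpTo-congᵇ : (n : ℕ) {g h : ℕ → E} → (∀ i → i < n → g i ≡ h i) → sumUpTo n g ≡ sumUpTo n h
  sumUpTo-congᵇ zero    g≗h = refl
  sumUpTo-congᵇ (suc n) g≗h = cong₂ _+_ (g≗h 0 (s≤s z≤n)) (sumUpTo-congᵇ n (λ i i<n → g≗h (suc i) (s≤s i<n)))

  sumUpTo-cong : (n : ℕ) {g h : ℕ → E} → (∀ i → g i ≡ h i) → sumUpTo n g ≡ sumUpTo n h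
  sumUpTo-cong n g≗h = sumUpTo-congᵇ n (λ i _ → g≗h i)

  sumUpTo-0 : (n : ℕ) {g : ℕ → E} → (∀ i → g i ≡ 0#) → sumUpTo n g ≡ 0#
  sumUpTo-0 zero    g≗0 = refl
  sumUpTo-0 (suc n) g≗0 = trans (cong₂ _+_ (g≗0 0) (sumUpTo-0 n (g≗0 ∘ suc))) (+-identityˡ 0#)

  sumUpTo-snoc : (n : ℕ) (g : ℕ → E) → sumUpTo (suc n) g ≡ sumUpTo n g + g n
  sumUpTo-snoc zero    g = trans (+-identityʳ _) (sym (+-identityˡ _))
  sumUpTo-snoc (suc n) g = trans (cong (g 0 +_) (sumUpTo-snoc n (g ∘ suc))) (sym (+-assoc _ _ _))

  sumUpTo-+ : (n : ℕ) (g h : ℕ → E) → sumUpTo n (λ i → g i + h i) ≡ sumUpTo n g + sumUpTo n h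
  sumUpTo-+ zero    g h = sym (+-identityˡ 0#)
  sumUpTo-+ (suc n) g h = trans (cong (g 0 + h 0 +_) (sumUpTo-+ n (g ∘ suc) (h ∘ suc)))
                                (interchange (g 0) (h 0) _ _)

  sumUpTo-*ˡ : (n : ℕ) (k : E) (g : ℕ → E) → sumUpTo n (λ i → k * g i) ≡ k * sumUpTo n g
  sumUpTo-*ˡ zero    k g = sym (zeroʳ k)
  sumUpTo-*ˡ (suc n) k g = trans (cong (k * g 0 +_) (sumUpTo-*ˡ n k (g ∘ suc))) (sym (distribˡ k _ _))

  sumUpTo-init : (n : ℕ) {g : ℕ → E} (h : ℕ → E) → (∀ i → i < n → g i ≡ h i) → g n ≡ 0# →
                 sumUpTo (suc n) g ≡ sumUpTo n h
  sumUpTo-init n {g} h g≗h gn≡0 = begin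
      sumUpTo (suc n) g  ≡⟨ sumUpTo-snoc n g ⟩
      sumUpTo n g + g n  ≡⟨ cong₂ _+_ (sumUpTo-congᵇ n g≗h) gn≡0 ⟩
      sumUpTo n h + 0#   ≡⟨ +-identityʳ _ ⟩
      sumUpTo n h        ∎
    where open ≡-Reasoning

  Exponents : Set
  Exponents = ℕ × ℕ × ℕ

  Coefficients : Set
  Coefficients = Exponents → E

  monomialValue : Point → E → Exponents → E
  monomialValue (x , y , z) c (a , b , e) = c * pow 𝔽 x a * pow 𝔽 y b * pow 𝔽 z e

  -- eval 𝔽 {d} F P unfolds to sumMonomials P (monomials d) F
  sumMonomials : Point → (ms : List Exponents) → Vec E (length ms) → E
  sumMonomials P ms F = foldr _+_ 0# (zipWith (monomialValue P) (toList F) ms)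

  term : Coefficients → Point → ℕ → ℕ → ℕ → E
  term c P a b e = monomialValue P (c (a , b , e)) (a , b , e)

  partWithXDegree : Coefficients → Point → ℕ → ℕ → E
  partWithXDegree c P a m = sumUpTo (suc m) (λ b → term c P a b (m ∸ b))

  -- Σ c(a,b,e) X^a Y^b Z^e over a + b + e = d, grouped by the X-degree a as in monomials d
  evalCoefficients : ℕ → Coefficients → Point → E
  evalCoefficients d c P = sumUpTo (suc d) (λ a → partWithXDegree c P a (d ∸ a))

  toForm : (ms : List Exponents) → Coefficients → Vec E (length ms)
  toForm []       c = []
  toForm (m ∷ ms) c = c m ∷ toForm ms c

  eval-toForm : (d : ℕ) (c : Coefficients) (P : Point) → eval 𝔽 {d} (toForm (monomials d) c) P ≡ evalCoefficients d c P
  eval-toForm d c P = begin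
      eval 𝔽 {d} (toForm (monomials d) c) P
        ≡⟨ sumMonomials-toForm (monomials d) ⟩
      sumList monomial (monomials d)
        ≡⟨ sumList-concatMap monomial row (applyUpTo (λ a → a) (suc d)) ⟩
      sumList (sumList monomial ∘ row) (applyUpTo (λ a → a) (suc d))
        ≡⟨ sumList-applyUpTo (sumList monomial ∘ row) (λ a → a) (suc d) ⟩
      sumUpTo (suc d) (sumList monomial ∘ row)
        ≡⟨ sumUpTo-cong (suc d) (λ a → trans (sumList-map monomial (λ b → (a , b , d ∸ a ∸ b)) (applyUpTo (λ b → b) (suc (d ∸ a))))
                                             (sumList-applyUpTo _ (λ b → b) (suc (d ∸ a)))) ⟩
      evalCoefficients d c P ∎
    where
    open ≡-Reasoning
    monomial : Exponents → E
    monomial (a , b , e) = term c P a b e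
    row : ℕ → List Exponents
    row a = map (λ b → (a , b , d ∸ a ∸ b)) (applyUpTo (λ b → b) (suc (d ∸ a)))
    sumMonomials-toForm : (ms : List Exponents) → sumMonomials P ms (toForm ms c) ≡ sumList monomial ms
    sumMonomials-toForm []       = refl
    sumMonomials-toForm (m ∷ ms) = cong (monomial m +_) (sumMonomials-toForm ms)

  Representable : ℕ → (Point → E) → Set
  Representable d f = Σ[ c ∈ Coefficients ] (∀ P → f P ≡ evalCoefficients d c P)

  representable-cong : {d : ℕ} {f g : Point → E} → (∀ P → f P ≡ g P) → Representable d f → Representable d g
  representable-cong f≗g (c , f≗c) = c , λ P → trans (sym (f≗g P)) (f≗c P)

  representable-+ : {d : ℕ} {f g : Point → E} → Representable d f → Representable d g →
                    Representable d (λ P → f P + g P)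
  representable-+ {d} {f} {g} (c , f≗c) (c′ , g≗c′) = (λ m → c m + c′ m) , λ P → begin
      f P + g P
        ≡⟨ cong₂ _+_ (f≗c P) (g≗c′ P) ⟩
      evalCoefficients d c P + evalCoefficients d c′ P
        ≡⟨ sumUpTo-+ (suc d) (λ a → partWithXDegree c P a (d ∸ a)) (λ a → partWithXDegree c′ P a (d ∸ a)) ⟨
      sumUpTo (suc d) (λ a → partWithXDegree c P a (d ∸ a) + partWithXDegree c′ P a (d ∸ a))
        ≡⟨ sumUpTo-cong (suc d) (λ a → sym (sumUpTo-+ (suc (d ∸ a)) (λ b → term c P a b (d ∸ a ∸ b))
                                                                    (λ b → term c′ P a b (d ∸ a ∸ b)))) ⟩
      sumUpTo (suc d) (λ a → sumUpTo (suc (d ∸ a)) (λ b → term c P a b (d ∸ a ∸ b) + term c′ P a b (d ∸ a ∸ b)))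
        ≡⟨ sumUpTo-cong (suc d) (λ a → sumUpTo-cong (suc (d ∸ a)) (λ b → sym (distribʳ-term P a b (d ∸ a ∸ b)))) ⟩
      evalCoefficients d (λ m → c m + c′ m) P ∎
    where
    open ≡-Reasoning
    distribʳ-term : ∀ P a b e → term (λ m → c m + c′ m) P a b e ≡ term c P a b e + term c′ P a b e
    distribʳ-term P a b e = solve 5 (λ u v X Y Z → (u :+ v) :* X :* Y :* Z := u :* X :* Y :* Z :+ v :* X :* Y :* Z)
                                  refl (c (a , b , e)) (c′ (a , b , e)) _ _ _

  representable-* : {d : ℕ} {f : Point → E} (k : E) → Representable d f → Representable d (λ P → k * f P)
  representable-* {d} {f} k (c , f≗c) = (λ m → k * c m) , λ P → begin
      k * f P
        ≡⟨ cong (k *_) (f≗c P) ⟩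
      k * evalCoefficients d c P
        ≡⟨ sumUpTo-*ˡ (suc d) k (λ a → partWithXDegree c P a (d ∸ a)) ⟨
      sumUpTo (suc d) (λ a → k * partWithXDegree c P a (d ∸ a))
        ≡⟨ sumUpTo-cong (suc d) (λ a → sym (sumUpTo-*ˡ (suc (d ∸ a)) k (λ b → term c P a b (d ∸ a ∸ b)))) ⟩
      sumUpTo (suc d) (λ a → sumUpTo (suc (d ∸ a)) (λ b → k * term c P a b (d ∸ a ∸ b)))
        ≡⟨ sumUpTo-cong (suc d) (λ a → sumUpTo-cong (suc (d ∸ a)) (λ b → sym (assoc-term P a b (d ∸ a ∸ b)))) ⟩
      evalCoefficients d (λ m → k * c m) P ∎
    where
    open ≡-Reasoning
    assoc-term : ∀ P a b e → term (λ m → k * c m) P a b e ≡ k * term c P a b e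
    assoc-term P a b e = solve 5 (λ u v X Y Z → (u :* v) :* X :* Y :* Z := u :* (v :* X :* Y :* Z))
                               refl k (c (a , b , e)) _ _ _

  representable-1 : Representable 0 (λ _ → 1#)
  representable-1 = (λ _ → 1#) , λ P → solve 0 (con 1 := con 1 :* con 1 :* con 1 :* con 1 :+ con 0 :+ con 0) refl

  shiftX shiftY shiftZ : Coefficients → Coefficients
  shiftX c (zero  , b , e) = 0#
  shiftX c (suc a , b , e) = c (a , b , e)
  shiftY c (a , zero  , e) = 0#
  shiftY c (a , suc b , e) = c (a , b , e)
  shiftZ c (a , b , zero)  = 0#
  shiftZ c (a , b , suc e) = c (a , b , e)

  term-0 : (c : Coefficients) (P : Point) (a b e : ℕ) → c (a , b , e) ≡ 0# → term c P a b e ≡ 0#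
  term-0 c P a b e c≡0 = trans (cong (λ u → u * _ * _ * _) c≡0) (solve 3 (λ X Y Z → con 0 :* X :* Y :* Z := con 0) refl _ _ _)

  module _ (c : Coefficients) (P : Point) where

    private
      x y z : E
      x = proj₁ P
      y = proj₁ (proj₂ P)
      z = proj₂ (proj₂ P)

    partWithXDegree-shiftX-0 : (m : ℕ) → partWithXDegree (shiftX c) P 0 m ≡ 0#
    partWithXDegree-shiftX-0 m = sumUpTo-0 (suc m) (λ b → term-0 (shiftX c) P 0 b (m ∸ b) refl)

    partWithXDegree-shiftX : (a m : ℕ) → partWithXDegree (shiftX c) P (suc a) m ≡ x * partWithXDegree c P a m
    partWithXDegree-shiftX a m =
      trans (sumUpTo-cong (suc m) (λ b → solve 5 (λ u x X Y Z → u :* (x :* X) :* Y :* Z := x :* (u :* X :* Y :* Z))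
                                                 refl (c (a , b , m ∸ b)) x (pow 𝔽 x a) (pow 𝔽 y b) (pow 𝔽 z (m ∸ b))))
            (sumUpTo-*ˡ (suc m) x (λ b → term c P a b (m ∸ b)))

    partWithXDegree-shiftY-0 : (a : ℕ) → partWithXDegree (shiftY c) P a 0 ≡ 0#
    partWithXDegree-shiftY-0 a = trans (+-identityʳ _) (term-0 (shiftY c) P a 0 0 refl)

    partWithXDegree-shiftY : (a m : ℕ) → partWithXDegree (shiftY c) P a (suc m) ≡ y * partWithXDegree c P a m
    partWithXDegree-shiftY a m = begin
        term (shiftY c) P a 0 (suc m) + sumUpTo (suc m) (λ b → term (shiftY c) P a (suc b) (m ∸ b))
          ≡⟨ cong₂ _+_ (term-0 (shiftY c) P a 0 (suc m) refl)
                       (sumUpTo-cong (suc m) (λ b → solve 5 (λ u y X Y Z → u :* X :* (y :* Y) :* Z := y :* (u :* X :* Y :* Z))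
                                                            refl (c (a , b , m ∸ b)) y (pow 𝔽 x a) (pow 𝔽 y b) (pow 𝔽 z (m ∸ b)))) ⟩
        0# + sumUpTo (suc m) (λ b → y * term c P a b (m ∸ b))
          ≡⟨ +-identityˡ _ ⟩
        sumUpTo (suc m) (λ b → y * term c P a b (m ∸ b))
          ≡⟨ sumUpTo-*ˡ (suc m) y (λ b → term c P a b (m ∸ b)) ⟩
        y * partWithXDegree c P a m ∎
      where open ≡-Reasoning

    partWithXDegree-shiftZ-0 : (a : ℕ) → partWithXDegree (shiftZ c) P a 0 ≡ 0#
    partWithXDegree-shiftZ-0 a = trans (+-identityʳ _) (term-0 (shiftZ c) P a 0 0 refl)

    partWithXDegree-shiftZ : (a m : ℕ) → partWithXDegree (shiftZ c) P a (suc m) ≡ z * partWithXDegree c P a m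
    partWithXDegree-shiftZ a m = begin
        partWithXDegree (shiftZ c) P a (suc m)
          ≡⟨ sumUpTo-init (suc m) (λ b → z * term c P a b (m ∸ b)) shifted lastTerm ⟩
        sumUpTo (suc m) (λ b → z * term c P a b (m ∸ b))
          ≡⟨ sumUpTo-*ˡ (suc m) z (λ b → term c P a b (m ∸ b)) ⟩
        z * partWithXDegree c P a m ∎
      where
      open ≡-Reasoning
      shifted : ∀ b → b < suc m → term (shiftZ c) P a b (suc m ∸ b) ≡ z * term c P a b (m ∸ b)
      shifted b b<1+m = trans (cong (term (shiftZ c) P a b) (ℕ.+-∸-assoc 1 (ℕ.≤-pred b<1+m)))
                              (solve 5 (λ u z X Y Z → u :* X :* Y :* (z :* Z) := z :* (u :* X :* Y :* Z))
                                       refl (c (a , b , m ∸ b)) z (pow 𝔽 x a) (pow 𝔽 y b) (pow 𝔽 z (m ∸ b)))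
      lastTerm : term (shiftZ c) P a (suc m) (m ∸ m) ≡ 0#
      lastTerm = trans (cong (term (shiftZ c) P a (suc m)) (ℕ.n∸n≡0 m)) (term-0 (shiftZ c) P a (suc m) 0 refl)

  evalCoefficients-shiftX : (d : ℕ) (c : Coefficients) (P : Point) →
                            evalCoefficients (suc d) (shiftX c) P ≡ proj₁ P * evalCoefficients d c P
  evalCoefficients-shiftX d c P =
    trans (cong₂ _+_ (partWithXDegree-shiftX-0 c P (suc d))
                     (sumUpTo-cong (suc d) (λ a → partWithXDegree-shiftX c P a (d ∸ a))))
          (trans (+-identityˡ _) (sumUpTo-*ˡ (suc d) (proj₁ P) (λ a → partWithXDegree c P a (d ∸ a))))

  -- shared by multiplication with Y and with Z, which do not change X-degrees
  evalCoefficients-shiftYZ : (d : ℕ) (c c′ : Coefficients) (P : Point) (w : E) →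
                             (∀ a m → partWithXDegree c′ P a (suc m) ≡ w * partWithXDegree c P a m) →
                             (∀ a → partWithXDegree c′ P a 0 ≡ 0#) →
                             evalCoefficients (suc d) c′ P ≡ w * evalCoefficients d c P
  evalCoefficients-shiftYZ d c c′ P w raise vanish = begin
      evalCoefficients (suc d) c′ P
        ≡⟨ sumUpTo-init (suc d) (λ a → w * partWithXDegree c P a (d ∸ a)) raised lastPart ⟩
      sumUpTo (suc d) (λ a → w * partWithXDegree c P a (d ∸ a))
        ≡⟨ sumUpTo-*ˡ (suc d) w (λ a → partWithXDegree c P a (d ∸ a)) ⟩
      w * evalCoefficients d c P ∎
    where
    open ≡-Reasoning
    raised : ∀ a → a < suc d → partWithXDegree c′ P a (suc d ∸ a) ≡ w * partWithXDegree c P a (d ∸ a)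
    raised a a<1+d = trans (cong (partWithXDegree c′ P a) (ℕ.+-∸-assoc 1 (ℕ.≤-pred a<1+d))) (raise a (d ∸ a))
    lastPart : partWithXDegree c′ P (suc d) (d ∸ d) ≡ 0#
    lastPart = trans (cong (partWithXDegree c′ P (suc d)) (ℕ.n∸n≡0 d)) (vanish (suc d))

  module _ {d : ℕ} {f : Point → E} where

    representable-X* : Representable d f → Representable (suc d) (λ P → proj₁ P * f P)
    representable-X* (c , f≗c) = shiftX c , λ P →
      trans (cong (proj₁ P *_) (f≗c P)) (sym (evalCoefficients-shiftX d c P))

    representable-Y* : Representable d f → Representable (suc d) (λ P → proj₁ (proj₂ P) * f P)
    representable-Y* (c , f≗c) = shiftY c , λ P →
      trans (cong (proj₁ (proj₂ P) *_) (f≗c P))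
            (sym (evalCoefficients-shiftYZ d c (shiftY c) P _ (partWithXDegree-shiftY c P) (partWithXDegree-shiftY-0 c P)))

    representable-Z* : Representable d f → Representable (suc d) (λ P → proj₂ (proj₂ P) * f P)
    representable-Z* (c , f≗c) = shiftZ c , λ P →
      trans (cong (proj₂ (proj₂ P) *_) (f≗c P))
            (sym (evalCoefficients-shiftYZ d c (shiftZ c) P _ (partWithXDegree-shiftZ c P) (partWithXDegree-shiftZ-0 c P)))

  form : {d : ℕ} {f : Point → E} → Representable d f → Form 𝔽 d
  form {d} (c , _) = toForm (monomials d) c

  eval-form : {d : ℕ} {f : Point → E} (r : Representable d f) (P : Point) → eval 𝔽 {d} (form r) P ≡ f P
  eval-form {d} (c , f≗c) P = trans (eval-toForm d c P) (sym (f≗c P))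

module ProjectivePlane (𝔽 : FiniteField) where

  open import Data.Nat using (ℕ; _+_; _*_)
  import Data.Nat.Properties as ℕ
  open import Data.Fin as Fin using (Fin)
  open import Data.List using (List; []; _∷_; _++_; map; concatMap; length; allFin)
  import Data.List.Properties as List
  open import Data.Product using (_,_)
  open import Function using (_∘_)
  open import Relation.Nullary using (yes; no; _×-dec_; map′)
  open import Relation.Binary.Definitions using (DecidableEquality)
  open import Relation.Binary.PropositionalEquality

  open Counting
  open Forms 𝔽 using (Point)
  open FiniteField 𝔽 using (q; 0#; 1#)

  private
    E : Set
    E = Elt 𝔽

  data ℙ² : Set where
    [1∶_∶_] : E → E → ℙ²
    [0∶1∶_] : E → ℙ²
    [0∶0∶1] : ℙ²

  coords : ℙ² → Point
  coords [1∶ y ∶ z ] = (1# , y , z)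
  coords [0∶1∶ z ]   = (0# , 1# , z)
  coords [0∶0∶1]     = (0# , 0# , 1#)

  elements : List E
  elements = allFin q

  length-elements : length elements ≡ q
  length-elements = List.length-tabulate (λ i → i)

  affinePoints : List ℙ²
  affinePoints = concatMap (λ y → map [1∶ y ∶_] elements) elements

  points : List ℙ²
  points = affinePoints ++ map [0∶1∶_] elements ++ [0∶0∶1] ∷ []

  P2≡map-coords : P2 𝔽 ≡ map coords points
  P2≡map-coords = sym (begin
      map coords points
        ≡⟨ List.map-++ coords affinePoints _ ⟩
      map coords affinePoints ++ map coords (map [0∶1∶_] elements ++ [0∶0∶1] ∷ [])
        ≡⟨ cong₂ _++_ (List.map-concatMap coords _ elements)
                      (trans (List.map-++ coords (map [0∶1∶_] elements) _)
                             (cong (_++ (0# , 0# , 1#) ∷ []) (sym (List.map-∘ elements)))) ⟩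
      concatMap (map coords ∘ λ y → map [1∶ y ∶_] elements) elements ++ map (coords ∘ [0∶1∶_]) elements ++ (0# , 0# , 1#) ∷ []
        ≡⟨ cong (_++ map (coords ∘ [0∶1∶_]) elements ++ (0# , 0# , 1#) ∷ [])
                (List.concatMap-cong (λ y → sym (List.map-∘ elements)) elements) ⟩
      P2 𝔽 ∎)
    where open ≡-Reasoning

  _≟ℙ_ : DecidableEquality ℙ²
  [1∶ y ∶ z ] ≟ℙ [1∶ y′ ∶ z′ ] = map′ (λ (y≡y′ , z≡z′) → cong₂ [1∶_∶_] y≡y′ z≡z′) (λ { refl → refl , refl })
                                      ((y Fin.≟ y′) ×-dec (z Fin.≟ z′))
  [0∶1∶ z ]   ≟ℙ [0∶1∶ z′ ]   = map′ (cong [0∶1∶_]) (λ { refl → refl }) (z Fin.≟ z′)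
  [0∶0∶1]     ≟ℙ [0∶0∶1]      = yes refl
  [1∶ _ ∶ _ ] ≟ℙ [0∶1∶ _ ]    = no λ ()
  [1∶ _ ∶ _ ] ≟ℙ [0∶0∶1]      = no λ ()
  [0∶1∶ _ ]   ≟ℙ [1∶ _ ∶ _ ]  = no λ ()
  [0∶1∶ _ ]   ≟ℙ [0∶0∶1]      = no λ ()
  [0∶0∶1]     ≟ℙ [1∶ _ ∶ _ ]  = no λ ()
  [0∶0∶1]     ≟ℙ [0∶1∶ _ ]    = no λ ()

  points-isEnumeration : IsEnumeration _≟ℙ_ points
  points-isEnumeration u = trans split (count u)
    where
    enum : IsEnumeration Fin._≟_ elements
    enum = allFin-isEnumeration q

    affine atInfinity : ℙ² → ℕ
    affine     u = ∑ (λ y → ∑ (λ z → χ (u ≟ℙ [1∶ y ∶ z ])) elements) elements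
    atInfinity u = ∑ (λ z → χ (u ≟ℙ [0∶1∶ z ])) elements

    split : ∑ (λ w → χ (u ≟ℙ w)) points ≡ affine u + (atInfinity u + (χ (u ≟ℙ [0∶0∶1]) + 0))
    split = trans (∑-++ _ affinePoints _)
                  (cong₂ _+_ (trans (∑-concatMap _ _ elements) (∑-cong (λ y → ∑-map _ _ elements) elements))
                             (trans (∑-++ _ (map [0∶1∶_] elements) _)
                                    (cong (_+ (χ (u ≟ℙ [0∶0∶1]) + 0)) (∑-map _ [0∶1∶_] elements))))

    affine-self : ∀ y₀ z₀ → affine [1∶ y₀ ∶ z₀ ] ≡ 1
    affine-self y₀ z₀ = begin
        ∑ (λ y → ∑ (λ z → χ ([1∶ y₀ ∶ z₀ ] ≟ℙ [1∶ y ∶ z ])) elements) elements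
          ≡⟨ ∑-cong (λ y → ∑-cong (λ z → χ-[1∶∶] y z) elements) elements ⟩
        ∑ (λ y → ∑ (λ z → χ (y₀ Fin.≟ y) * χ (z₀ Fin.≟ z)) elements) elements
          ≡⟨ ∑-cong (λ y → ∑-*ˡ (χ (y₀ Fin.≟ y)) _ elements) elements ⟩
        ∑ (λ y → χ (y₀ Fin.≟ y) * ∑ (λ z → χ (z₀ Fin.≟ z)) elements) elements
          ≡⟨ ∑-pick Fin._≟_ elements enum y₀ _ ⟩
        ∑ (λ z → χ (z₀ Fin.≟ z)) elements
          ≡⟨ enum z₀ ⟩
        1 ∎
      where
      open ≡-Reasoning
      χ-[1∶∶] : ∀ y z → χ ([1∶ y₀ ∶ z₀ ] ≟ℙ [1∶ y ∶ z ]) ≡ χ (y₀ Fin.≟ y) * χ (z₀ Fin.≟ z)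
      χ-[1∶∶] y z = trans (χ-cong (λ { refl → refl , refl }) (λ (y≡ , z≡) → cong₂ [1∶_∶_] y≡ z≡) _ _)
                          (χ-× (y₀ Fin.≟ y) (z₀ Fin.≟ z))

    atInfinity-self : ∀ z₀ → atInfinity [0∶1∶ z₀ ] ≡ 1
    atInfinity-self z₀ = trans (∑-cong (λ z → χ-cong (λ { refl → refl }) (cong [0∶1∶_]) _ (z₀ Fin.≟ z)) elements) (enum z₀)

    count : ∀ u → affine u + (atInfinity u + (χ (u ≟ℙ [0∶0∶1]) + 0)) ≡ 1
    count [1∶ y₀ ∶ z₀ ] = cong₂ _+_ (affine-self y₀ z₀) (cong (_+ 0) (∑-0 (λ _ → refl) elements))
    count [0∶1∶ z₀ ]    = cong₂ _+_ (∑-0 (λ _ → ∑-0 (λ _ → refl) elements) elements) (cong (_+ 0) (atInfinity-self z₀))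
    count [0∶0∶1]       = cong₂ _+_ (∑-0 (λ _ → ∑-0 (λ _ → refl) elements) elements) (cong (_+ 1) (∑-0 (λ _ → refl) elements))

  length-points : length points ≡ q * q + q + 1
  length-points = begin
      length points
        ≡⟨ List.length-++ affinePoints ⟩
      length affinePoints + length (map [0∶1∶_] elements ++ [0∶0∶1] ∷ [])
        ≡⟨ cong₂ _+_ (trans (length-concatMap _ elements)
                            (trans (∑-cong (λ y → List.length-map _ elements) elements) (∑-const _ elements)))
                     (trans (List.length-++ (map [0∶1∶_] elements)) (cong (_+ 1) (List.length-map _ elements))) ⟩
      length elements * length elements + (length elements + 1)
        ≡⟨ cong (λ n → n * n + (n + 1)) length-elements ⟩
      q * q + (q + 1)
        ≡⟨ ℕ.+-assoc (q * q) q 1 ⟨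
      q * q + q + 1 ∎
    where open ≡-Reasoning

module Indicators (𝔽 : FiniteField) where

  open import Data.Nat as ℕ using (ℕ; suc; _∸_; _≤_; s≤s)
  import Data.Nat.Properties as ℕ
  open import Data.Fin as Fin using ()
  open import Data.List using (List; []; _∷_; _++_; map; length; filter; replicate)
  import Data.List.Properties as List
  open import Data.List.Membership.Propositional using (_∈_; lose)
  open import Data.List.Membership.Propositional.Properties using (∈-filter⁺; ∈-allFin)
  open import Data.List.Relation.Unary.Any using (Any; here; there)
  import Data.List.Relation.Unary.Any.Properties as Any
  open import Data.List.Relation.Unary.All as All using (All; []; _∷_)
  import Data.List.Relation.Unary.All.Properties as All
  open import Data.Product using (_,_; proj₁; proj₂)
  open import Data.Empty using (⊥-elim)
  open import Function using (_∘_)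
  open import Relation.Nullary using (yes; no; ¬?)
  open import Relation.Binary.PropositionalEquality
  open import Algebra.Bundles using (CommutativeRing)

  open Forms 𝔽
  open ProjectivePlane 𝔽

  open FiniteField 𝔽
  open CommutativeRing ring
    using (+-identityʳ; *-assoc; *-comm; *-identityˡ; *-identityʳ; zeroˡ; zeroʳ; -‿inverseʳ; +-group; commutativeSemiring)
  open import Algebra.Solver.Ring.NaturalCoefficients.Default commutativeSemiring
  open import Algebra.Properties.Group +-group using (x∙y⁻¹≈ε⇒x≈y)

  private
    E : Set
    E = Elt 𝔽

  1≢0 : 1# ≢ 0#
  1≢0 = 0≢1 ∘ sym

  *-nonzero : {x y : E} → x ≢ 0# → y ≢ 0# → x * y ≢ 0#
  *-nonzero {x} {y} x≢0 y≢0 xy≡0 = y≢0 (begin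
      y              ≡⟨ *-identityˡ y ⟨
      1# * y         ≡⟨ cong (_* y) (trans (*-comm x⁻¹ x) (proj₂ (inverse x x≢0))) ⟨
      x⁻¹ * x * y    ≡⟨ *-assoc x⁻¹ x y ⟩
      x⁻¹ * (x * y)  ≡⟨ cong (x⁻¹ *_) xy≡0 ⟩
      x⁻¹ * 0#       ≡⟨ zeroʳ x⁻¹ ⟩
      0#             ∎)
    where
    open ≡-Reasoning
    x⁻¹ : E
    x⁻¹ = proj₁ (inverse x x≢0)

  x-v*1≡0⇒x≡v : {x v : E} → x + - v * 1# ≡ 0# → x ≡ v
  x-v*1≡0⇒x≡v {x} {v} eq = x∙y⁻¹≈ε⇒x≈y x v (trans (cong (x +_) (sym (*-identityʳ (- v)))) eq)

  x-v*1≢0 : {x v : E} → v ≢ x → x + - v * 1# ≢ 0#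
  x-v*1≢0 v≢x = v≢x ∘ sym ∘ x-v*1≡0⇒x≡v

  x-x*1≡0 : (x : E) → x + - x * 1# ≡ 0#
  x-x*1≡0 x = trans (cong (x +_) (*-identityʳ (- x))) (-‿inverseʳ x)

  x-v*0≡x : (x v : E) → x + - v * 0# ≡ x
  x-v*0≡x x v = trans (cong (x +_) (zeroʳ (- v))) (+-identityʳ x)

  1-v*0≢0 : (v : E) → 1# + - v * 0# ≢ 0#
  1-v*0≢0 v = 1≢0 ∘ trans (sym (x-v*0≡x 1# v))

  private
    collect : ∀ v a b f → a * f + v * (b * f) ≡ (a + v * b) * f
    collect = solve 4 (λ v a b f → a :* f :+ v :* (b :* f) := (a :+ v :* b) :* f) refl

  data Factor : Set where
    X Y Z             : Factor
    Y-_·X Z-_·X Z-_·Y : E → Factor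

  evalFactor : Factor → Point → E
  evalFactor X         (x , y , z) = x
  evalFactor Y         (x , y , z) = y
  evalFactor Z         (x , y , z) = z
  evalFactor (Y- u ·X) (x , y , z) = y + - u * x
  evalFactor (Z- u ·X) (x , y , z) = z + - u * x
  evalFactor (Z- u ·Y) (x , y , z) = z + - u * y

  representable-factor* : {d : ℕ} {f : Point → E} (ℓ : Factor) →
                          Representable d f → Representable (suc d) (λ P → evalFactor ℓ P * f P)
  representable-factor* X         r = representable-X* r
  representable-factor* Y         r = representable-Y* r
  representable-factor* Z         r = representable-Z* r
  representable-factor* (Y- u ·X) r = representable-cong (λ P → collect (- u) _ _ _)
    (representable-+ (representable-Y* r) (representable-* (- u) (representable-X* r)))
  representable-factor* (Z- u ·X) r = representable-cong (λ P → collect (- u) _ _ _)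
    (representable-+ (representable-Z* r) (representable-* (- u) (representable-X* r)))
  representable-factor* (Z- u ·Y) r = representable-cong (λ P → collect (- u) _ _ _)
    (representable-+ (representable-Z* r) (representable-* (- u) (representable-Y* r)))

  evalProduct : List Factor → Point → E
  evalProduct []       P = 1#
  evalProduct (ℓ ∷ ℓs) P = evalFactor ℓ P * evalProduct ℓs P

  representable-product : (ℓs : List Factor) → Representable (length ℓs) (evalProduct ℓs)
  representable-product []       = representable-1
  representable-product (ℓ ∷ ℓs) = representable-factor* ℓ (representable-product ℓs)

  evalProduct-≡0 : {ℓs : List Factor} (P : Point) → Any (λ ℓ → evalFactor ℓ P ≡ 0#) ℓs → evalProduct ℓs P ≡ 0#
  evalProduct-≡0 {ℓ ∷ ℓs} P (here ℓ≡0)   = trans (cong (_* evalProduct ℓs P) ℓ≡0) (zeroˡ _)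
  evalProduct-≡0 {ℓ ∷ ℓs} P (there ℓs≡0) = trans (cong (evalFactor ℓ P *_) (evalProduct-≡0 P ℓs≡0)) (zeroʳ _)

  evalProduct-≢0 : {ℓs : List Factor} (P : Point) → All (λ ℓ → evalFactor ℓ P ≢ 0#) ℓs → evalProduct ℓs P ≢ 0#
  evalProduct-≢0 P []           = 1≢0
  evalProduct-≢0 P (ℓ≢0 ∷ ℓs≢0) = *-nonzero ℓ≢0 (evalProduct-≢0 P ℓs≢0)

  others : E → List E
  others u = filter (λ v → ¬? (v Fin.≟ u)) elements

  ∈-others : {u v : E} → v ≢ u → v ∈ others u
  ∈-others {v = v} v≢u = ∈-filter⁺ (λ w → ¬? (w Fin.≟ _)) (∈-allFin v) v≢u

  -- lines avoiding u whose union contains every other rational point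
  vanishingFactors : ℙ² → List Factor
  vanishingFactors [1∶ y ∶ z ] = X ∷ map Y-_·X (others y) ++ map Z-_·X (others z)
  vanishingFactors [0∶1∶ z ]   = map Y-_·X elements ++ map Z-_·Y (others z)
  vanishingFactors [0∶0∶1]     = map Z-_·X elements ++ map Z-_·Y elements

  vanishingFactors-≢0 : (u : ℙ²) → All (λ ℓ → evalFactor ℓ (coords u) ≢ 0#) (vanishingFactors u)
  vanishingFactors-≢0 [1∶ y ∶ z ] = 1≢0 ∷ All.++⁺ (All.map⁺ (others-≢0 y)) (All.map⁺ (others-≢0 z))
    where
    others-≢0 : ∀ u → All (λ v → u + - v * 1# ≢ 0#) (others u)
    others-≢0 u = All.map x-v*1≢0 (All.all-filter _ elements)
  vanishingFactors-≢0 [0∶1∶ z ]   = All.++⁺ (All.map⁺ (All.universal 1-v*0≢0 elements))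
                                            (All.map⁺ (All.map x-v*1≢0 (All.all-filter _ elements)))
  vanishingFactors-≢0 [0∶0∶1]     = All.++⁺ (All.map⁺ (All.universal 1-v*0≢0 elements))
                                            (All.map⁺ (All.universal 1-v*0≢0 elements))

  vanishingFactors-vanish : (u w : ℙ²) → w ≢ u → Any (λ ℓ → evalFactor ℓ (coords w) ≡ 0#) (vanishingFactors u)
  vanishingFactors-vanish [1∶ y₀ ∶ z₀ ] [1∶ y ∶ z ] w≢u with y Fin.≟ y₀ | z Fin.≟ z₀
  ... | yes refl | yes refl = ⊥-elim (w≢u refl)
  ... | no y≢y₀  | _        = there (Any.++⁺ˡ (Any.map⁺ (lose (∈-others y≢y₀) (x-x*1≡0 y))))
  ... | yes _    | no z≢z₀  = there (Any.++⁺ʳ (map Y-_·X (others y₀)) (Any.map⁺ (lose (∈-others z≢z₀) (x-x*1≡0 z))))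
  vanishingFactors-vanish [1∶ _ ∶ _ ] [0∶1∶ _ ]   _ = here refl
  vanishingFactors-vanish [1∶ _ ∶ _ ] [0∶0∶1]     _ = here refl
  vanishingFactors-vanish [0∶1∶ _ ]   [1∶ y ∶ z ] _ = Any.++⁺ˡ (Any.map⁺ (lose (∈-allFin y) (x-x*1≡0 y)))
  vanishingFactors-vanish [0∶1∶ z₀ ]  [0∶1∶ z ]   w≢u with z Fin.≟ z₀
  ... | yes refl = ⊥-elim (w≢u refl)
  ... | no z≢z₀  = Any.++⁺ʳ (map Y-_·X elements) (Any.map⁺ (lose (∈-others z≢z₀) (x-x*1≡0 z)))
  vanishingFactors-vanish [0∶1∶ _ ]   [0∶0∶1]     _ = Any.++⁺ˡ (Any.map⁺ (lose (∈-allFin 0#) (x-v*0≡x 0# 0#)))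
  vanishingFactors-vanish [0∶0∶1]     [1∶ y ∶ z ] _ = Any.++⁺ˡ (Any.map⁺ (lose (∈-allFin z) (x-x*1≡0 z)))
  vanishingFactors-vanish [0∶0∶1]     [0∶1∶ z ]   _ = Any.++⁺ʳ (map Z-_·X elements) (Any.map⁺ (lose (∈-allFin z) (x-x*1≡0 z)))
  vanishingFactors-vanish [0∶0∶1]     [0∶0∶1]   w≢u = ⊥-elim (w≢u refl)

  private
    elements≤q : length elements ≤ q
    elements≤q = ℕ.≤-reflexive length-elements

    others≤q : ∀ u → length (others u) ≤ q
    others≤q u = ℕ.≤-trans (List.length-filter _ elements) elements≤q

    length-map++map : (f : E → Factor) (us : List E) (g : E → Factor) (vs : List E) →
                      length us ≤ q → length vs ≤ q → length (map f us ++ map g vs) ≤ q ℕ.+ q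
    length-map++map f us g vs us≤q vs≤q = begin
        length (map f us ++ map g vs)           ≡⟨ List.length-++ (map f us) ⟩
        length (map f us) ℕ.+ length (map g vs) ≡⟨ cong₂ ℕ._+_ (List.length-map f us) (List.length-map g vs) ⟩
        length us ℕ.+ length vs                 ≤⟨ ℕ.+-mono-≤ us≤q vs≤q ⟩
        q ℕ.+ q                                 ∎
      where open ℕ.≤-Reasoning

  length-vanishingFactors : (u : ℙ²) → length (vanishingFactors u) ≤ suc (q ℕ.+ q)
  length-vanishingFactors [1∶ y ∶ z ] =
    s≤s (length-map++map Y-_·X (others y) Z-_·X (others z) (others≤q y) (others≤q z))
  length-vanishingFactors [0∶1∶ z ]   =
    ℕ.m≤n⇒m≤1+n (length-map++map Y-_·X elements Z-_·Y (others z) elements≤q (others≤q z))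
  length-vanishingFactors [0∶0∶1]     =
    ℕ.m≤n⇒m≤1+n (length-map++map Z-_·X elements Z-_·Y elements elements≤q elements≤q)

  padding : ℙ² → Factor
  padding [1∶ _ ∶ _ ] = X
  padding [0∶1∶ _ ]   = Y
  padding [0∶0∶1]     = Z

  padding-≢0 : (u : ℙ²) → evalFactor (padding u) (coords u) ≢ 0#
  padding-≢0 [1∶ _ ∶ _ ] = 1≢0
  padding-≢0 [0∶1∶ _ ]   = 1≢0
  padding-≢0 [0∶0∶1]     = 1≢0

  module _ (d : ℕ) (2q+1≤d : suc (q ℕ.+ q) ≤ d) where

    indicatorFactors : ℙ² → List Factor
    indicatorFactors u = replicate (d ∸ length (vanishingFactors u)) (padding u) ++ vanishingFactors u

    length-indicatorFactors : (u : ℙ²) → length (indicatorFactors u) ≡ d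
    length-indicatorFactors u = begin
        length (indicatorFactors u)                   ≡⟨ List.length-++ (replicate (d ∸ n) (padding u)) ⟩
        length (replicate (d ∸ n) (padding u)) ℕ.+ n  ≡⟨ cong (ℕ._+ n) (List.length-replicate (d ∸ n)) ⟩
        d ∸ n ℕ.+ n                                   ≡⟨ ℕ.m∸n+n≡m (ℕ.≤-trans (length-vanishingFactors u) 2q+1≤d) ⟩
        d                                             ∎
      where
      open ≡-Reasoning
      n : ℕ
      n = length (vanishingFactors u)

    indicatorFactors-≢0 : (u : ℙ²) → evalProduct (indicatorFactors u) (coords u) ≢ 0#
    indicatorFactors-≢0 u = evalProduct-≢0 {indicatorFactors u} (coords u)
      (All.++⁺ (All.replicate⁺ _ (padding-≢0 u)) (vanishingFactors-≢0 u))

    indicatorFactors-≡0 : (u w : ℙ²) → w ≢ u → evalProduct (indicatorFactors u) (coords w) ≡ 0#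
    indicatorFactors-≡0 u w w≢u = evalProduct-≡0 {indicatorFactors u} (coords w)
      (Any.++⁺ʳ (replicate _ (padding u)) (vanishingFactors-vanish u w w≢u))

    normaliser : ℙ² → E
    normaliser u = proj₁ (inverse _ (indicatorFactors-≢0 u))

    representable-indicator : (u : ℙ²) → Representable d (λ P → normaliser u * evalProduct (indicatorFactors u) P)
    representable-indicator u = representable-* (normaliser u)
      (subst (λ n → Representable n (evalProduct (indicatorFactors u)))
             (length-indicatorFactors u) (representable-product (indicatorFactors u)))

    indicator : ℙ² → Form 𝔽 d
    indicator u = form (representable-indicator u)

    indicator-self : (u : ℙ²) → eval 𝔽 {d} (indicator u) (coords u) ≡ 1#
    indicator-self u = trans (eval-form (representable-indicator u) (coords u))
                             (trans (*-comm (normaliser u) _) (proj₂ (inverse _ (indicatorFactors-≢0 u))))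

    indicator-other : (u w : ℙ²) → w ≢ u → eval 𝔽 {d} (indicator u) (coords w) ≡ 0#
    indicator-other u w w≢u = trans (eval-form (representable-indicator u) (coords w))
                                    (trans (cong (normaliser u *_) (indicatorFactors-≡0 u w w≢u)) (zeroʳ _))

module EvaluationMap (𝔽 : FiniteField) where

  open import Data.Nat as ℕ using (ℕ; suc; _≤_; _^_)
  open import Data.Fin as Fin using ()
  open import Data.List using (List; []; _∷_; length)
  open import Data.List.Relation.Unary.All as All using (All; []; _∷_)
  open import Data.List.Relation.Unary.AllPairs using ([]; _∷_)
  open import Data.List.Relation.Unary.Unique.Propositional using (Unique)
  open import Data.Vec as Vec using (Vec; []; _∷_)
  import Data.Vec.Properties as Vec
  open import Data.Product using (_,_)
  open import Function using (_∘_)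
  open import Relation.Binary.Definitions using (DecidableEquality)
  open import Relation.Binary.PropositionalEquality
  open import Algebra.Bundles using (CommutativeRing)

  open Forms 𝔽
  open ProjectivePlane 𝔽
  open Indicators 𝔽
  open Counting

  open FiniteField 𝔽
  open CommutativeRing ring using (+-identityˡ; +-identityʳ; *-identityˡ; -‿inverseˡ; distribʳ; zeroˡ; commutativeSemiring)
  open import Algebra.Solver.Ring.NaturalCoefficients.Default commutativeSemiring

  private
    E : Set
    E = Elt 𝔽

  linComb : {n : ℕ} → E → Vec E n → E → Vec E n → Vec E n
  linComb α F β G = Vec.zipWith (λ a b → α * a + β * b) F G

  sumMonomials-linComb : (α β : E) (P : Point) (ms : List Exponents) (F G : Vec E (length ms)) →
                         sumMonomials P ms (linComb α F β G) ≡ α * sumMonomials P ms F + β * sumMonomials P ms G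
  sumMonomials-linComb α β P []       [] [] = solve 2 (λ α β → con 0 := α :* con 0 :+ β :* con 0) refl α β
  sumMonomials-linComb α β P@(x , y , z) (m@(a , b , e) ∷ ms) (c ∷ F) (c′ ∷ G) =
    trans (cong (monomialValue P (α * c + β * c′) m +_) (sumMonomials-linComb α β P ms F G))
          (solve 9 (λ α β c c′ X Y Z S S′ → (α :* c :+ β :* c′) :* X :* Y :* Z :+ (α :* S :+ β :* S′)
                                             := α :* (c :* X :* Y :* Z :+ S) :+ β :* (c′ :* X :* Y :* Z :+ S′))
                   refl α β c c′ (pow 𝔽 x a) (pow 𝔽 y b) (pow 𝔽 z e) (sumMonomials P ms F) (sumMonomials P ms G))

  sumMonomials-0 : (P : Point) (ms : List Exponents) → sumMonomials P ms (Vec.replicate _ 0#) ≡ 0#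
  sumMonomials-0 P []       = refl
  sumMonomials-0 P (m ∷ ms) = trans (cong (monomialValue P 0# m +_) (sumMonomials-0 P ms))
                                    (solve 3 (λ X Y Z → con 0 :* X :* Y :* Z :+ con 0 := con 0) refl _ _ _)

  eval-linComb : {d : ℕ} (α : E) (F : Form 𝔽 d) (β : E) (G : Form 𝔽 d) (P : Point) →
                 eval 𝔽 {d} (linComb α F β G) P ≡ α * eval 𝔽 {d} F P + β * eval 𝔽 {d} G P
  eval-linComb {d} α F β G P = sumMonomials-linComb α β P (monomials d) F G

  eval-0 : {d : ℕ} (P : Point) → eval 𝔽 {d} (Vec.replicate _ 0#) P ≡ 0#
  eval-0 {d} P = sumMonomials-0 P (monomials d)

  _⊕_ _⊖_ : {n : ℕ} → Vec E n → Vec E n → Vec E n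
  F ⊕ G = linComb 1# F 1# G
  F ⊖ G = linComb 1# F (- 1#) G

  -1*b+b≡0 : (b : E) → - 1# * b + b ≡ 0#
  -1*b+b≡0 b = begin
      - 1# * b + b       ≡⟨ cong (- 1# * b +_) (*-identityˡ b) ⟨
      - 1# * b + 1# * b  ≡⟨ distribʳ b (- 1#) 1# ⟨
      (- 1# + 1#) * b    ≡⟨ cong (_* b) (-‿inverseˡ 1#) ⟩
      0# * b             ≡⟨ zeroˡ b ⟩
      0#                 ∎
    where open ≡-Reasoning

  private
    ⊖-⊕-pointwise : ∀ a b → 1# * (1# * a + - 1# * b) + 1# * b ≡ a
    ⊖-⊕-pointwise a b = trans (solve 3 (λ m a b → con 1 :* (con 1 :* a :+ m :* b) :+ con 1 :* b := a :+ (m :* b :+ b))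
                                       refl (- 1#) a b)
                              (trans (cong (a +_) (-1*b+b≡0 b)) (+-identityʳ a))

    ⊕-⊖-pointwise : ∀ a b → 1# * (1# * a + 1# * b) + - 1# * b ≡ a
    ⊕-⊖-pointwise a b = trans (solve 3 (λ m a b → con 1 :* (con 1 :* a :+ con 1 :* b) :+ m :* b := a :+ (m :* b :+ b))
                                       refl (- 1#) a b)
                              (trans (cong (a +_) (-1*b+b≡0 b)) (+-identityʳ a))

  ⊖-⊕ : {n : ℕ} (F G : Vec E n) → (F ⊖ G) ⊕ G ≡ F
  ⊖-⊕ []      []      = refl
  ⊖-⊕ (a ∷ F) (b ∷ G) = cong₂ _∷_ (⊖-⊕-pointwise a b) (⊖-⊕ F G)

  ⊕-⊖ : {n : ℕ} (F G : Vec E n) → (F ⊕ G) ⊖ G ≡ F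
  ⊕-⊖ []      []      = refl
  ⊕-⊖ (a ∷ F) (b ∷ G) = cong₂ _∷_ (⊕-⊖-pointwise a b) (⊕-⊖ F G)

  ⊖-self : {n : ℕ} (F : Vec E n) → F ⊖ F ≡ Vec.replicate n 0#
  ⊖-self []      = refl
  ⊖-self (a ∷ F) = cong₂ _∷_ (trans (solve 2 (λ m a → con 1 :* a :+ m :* a := m :* a :+ a) refl (- 1#) a) (-1*b+b≡0 a))
                             (⊖-self F)

  ⊖≡0⇒≡ : {n : ℕ} (F G : Vec E n) → F ⊖ G ≡ Vec.replicate n 0# → F ≡ G
  ⊖≡0⇒≡ []      []      _   = refl
  ⊖≡0⇒≡ (a ∷ F) (b ∷ G) eq = cong₂ _∷_ a≡b (⊖≡0⇒≡ F G (Vec.∷-injectiveʳ eq))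
    where
    open ≡-Reasoning
    a≡b : a ≡ b
    a≡b = begin
      a                              ≡⟨ +-identityʳ a ⟨
      a + 0#                         ≡⟨ cong (a +_) (-1*b+b≡0 b) ⟨
      a + (- 1# * b + b)             ≡⟨ solve 3 (λ m a b → a :+ (m :* b :+ b) := con 1 :* a :+ m :* b :+ b) refl (- 1#) a b ⟩
      1# * a + - 1# * b + b          ≡⟨ cong (_+ b) (Vec.∷-injectiveˡ eq) ⟩
      0# + b                         ≡⟨ +-identityˡ b ⟩
      b                              ∎

  _≟ᵥ_ : {n : ℕ} → DecidableEquality (Vec E n)
  _≟ᵥ_ = Vec.≡-dec Fin._≟_

  vectors-isEnumeration : (n : ℕ) → IsEnumeration _≟ᵥ_ (allVecs elements n)
  vectors-isEnumeration = allVecs-isEnumeration Fin._≟_ elements (allFin-isEnumeration q)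

  length-vectors : (n : ℕ) → length (allVecs elements n) ≡ q ^ n
  length-vectors n = trans (length-allVecs elements n) (cong (_^ n) length-elements)

  tabulateOn : {A B : Set} (L : List A) → (A → B) → Vec B (length L)
  tabulateOn []      f = []
  tabulateOn (x ∷ L) f = f x ∷ tabulateOn L f

  tabulateOn-cong : {A B : Set} {L : List A} {f g : A → B} → All (λ x → f x ≡ g x) L → tabulateOn L f ≡ tabulateOn L g
  tabulateOn-cong []             = refl
  tabulateOn-cong (fx≡gx ∷ f≗g) = cong₂ _∷_ fx≡gx (tabulateOn-cong f≗g)

  tabulateOn-linComb : {A : Set} (L : List A) (α : E) (f : A → E) (β : E) (g : A → E) →
                       tabulateOn L (λ x → α * f x + β * g x) ≡ linComb α (tabulateOn L f) β (tabulateOn L g)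
  tabulateOn-linComb []      α f β g = refl
  tabulateOn-linComb (x ∷ L) α f β g = cong (_ ∷_) (tabulateOn-linComb L α f β g)

  module _ (d : ℕ) (2q+1≤d : suc (q ℕ.+ q) ≤ d) where

    evalAt : Form 𝔽 d → ℙ² → E
    evalAt F u = eval 𝔽 {d} F (coords u)

    evalAt-linComb : (α : E) (F : Form 𝔽 d) (β : E) (G : Form 𝔽 d) (u : ℙ²) →
                     evalAt (linComb α F β G) u ≡ α * evalAt F u + β * evalAt G u
    evalAt-linComb α F β G u = eval-linComb {d} α F β G (coords u)

    interpolate : (L : List ℙ²) → Vec E (length L) → Form 𝔽 d
    interpolate []      []      = Vec.replicate _ 0#
    interpolate (w ∷ L) (a ∷ v) = linComb a (indicator d 2q+1≤d w) 1# (interpolate L v)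

    interpolate-vanishes : (L : List ℙ²) (v : Vec E (length L)) (u : ℙ²) → All (u ≢_) L → evalAt (interpolate L v) u ≡ 0#
    interpolate-vanishes []      []      u []            = eval-0 {d} (coords u)
    interpolate-vanishes (w ∷ L) (a ∷ v) u (u≢w ∷ u∉L) = begin
        evalAt (linComb a (indicator d 2q+1≤d w) 1# (interpolate L v)) u
          ≡⟨ evalAt-linComb a (indicator d 2q+1≤d w) 1# (interpolate L v) u ⟩
        a * evalAt (indicator d 2q+1≤d w) u + 1# * evalAt (interpolate L v) u
          ≡⟨ cong₂ (λ i r → a * i + 1# * r) (indicator-other d 2q+1≤d w u u≢w) (interpolate-vanishes L v u u∉L) ⟩
        a * 0# + 1# * 0#
          ≡⟨ solve 1 (λ a → a :* con 0 :+ con 1 :* con 0 := con 0) refl a ⟩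
        0# ∎
      where open ≡-Reasoning

    tabulateOn-interpolate : (L : List ℙ²) → Unique L → (v : Vec E (length L)) → tabulateOn L (evalAt (interpolate L v)) ≡ v
    tabulateOn-interpolate []      []              []      = refl
    tabulateOn-interpolate (w ∷ L) (w∉L ∷ uniqueL) (a ∷ v) =
      cong₂ _∷_ atW (trans (tabulateOn-cong onL) (tabulateOn-interpolate L uniqueL v))
      where
      open ≡-Reasoning
      atW : evalAt (interpolate (w ∷ L) (a ∷ v)) w ≡ a
      atW = begin
        evalAt (linComb a (indicator d 2q+1≤d w) 1# (interpolate L v)) w
          ≡⟨ evalAt-linComb a (indicator d 2q+1≤d w) 1# (interpolate L v) w ⟩
        a * evalAt (indicator d 2q+1≤d w) w + 1# * evalAt (interpolate L v) w
          ≡⟨ cong₂ (λ i r → a * i + 1# * r) (indicator-self d 2q+1≤d w) (interpolate-vanishes L v w w∉L) ⟩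
        a * 1# + 1# * 0#
          ≡⟨ solve 1 (λ a → a :* con 1 :+ con 1 :* con 0 := a) refl a ⟩
        a ∎
      onL : All (λ u → evalAt (interpolate (w ∷ L) (a ∷ v)) u ≡ evalAt (interpolate L v) u) L
      onL = All.map (λ {u} w≢u → begin
        evalAt (linComb a (indicator d 2q+1≤d w) 1# (interpolate L v)) u
          ≡⟨ evalAt-linComb a (indicator d 2q+1≤d w) 1# (interpolate L v) u ⟩
        a * evalAt (indicator d 2q+1≤d w) u + 1# * evalAt (interpolate L v) u
          ≡⟨ cong (λ i → a * i + 1# * evalAt (interpolate L v) u) (indicator-other d 2q+1≤d w u (w≢u ∘ sym)) ⟩
        a * 0# + 1# * evalAt (interpolate L v) u
          ≡⟨ solve 2 (λ a r → a :* con 0 :+ con 1 :* r := r) refl a _ ⟩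
        evalAt (interpolate L v) u ∎) w∉L

    values : Form 𝔽 d → Vec E (length points)
    values F = tabulateOn points (evalAt F)

    values-⊖ : (F G : Form 𝔽 d) → values (F ⊖ G) ≡ values F ⊖ values G
    values-⊖ F G = trans (tabulateOn-cong (All.universal (evalAt-linComb 1# F (- 1#) G) points))
                         (tabulateOn-linComb points 1# (evalAt F) (- 1#) (evalAt G))

    values-interpolate : (v : Vec E (length points)) → values (interpolate points v) ≡ v
    values-interpolate = tabulateOn-interpolate points (isEnumeration⇒Unique _≟ℙ_ points points-isEnumeration)

    fibreSize : Vec E (length points) → ℕ
    fibreSize v = ∑ (λ F → χ (values F ≟ᵥ v)) (S 𝔽 d)

    kernelSize : ℕ
    kernelSize = fibreSize (Vec.replicate _ 0#)

    -- translation by a preimage of v maps the fibre over v bijectively onto the kernel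
    fibreSize≡kernelSize : (v : Vec E (length points)) → fibreSize v ≡ kernelSize
    fibreSize≡kernelSize v = begin
        ∑ (λ F → χ (values F ≟ᵥ v)) (S 𝔽 d)
          ≡⟨ ∑-cong (λ F → χ-cong (to F) (from F) (values F ≟ᵥ v) _) (S 𝔽 d) ⟩
        ∑ (λ F → χ (values (F ⊖ σ) ≟ᵥ 0⃗)) (S 𝔽 d)
          ≡⟨ ∑-bijection _≟ᵥ_ (S 𝔽 d) (vectors-isEnumeration _) (_⊖ σ) (_⊕ σ) (λ F → ⊖-⊕ F σ) (λ F → ⊕-⊖ F σ) _ ⟩
        kernelSize ∎
      where
      open ≡-Reasoning
      σ : Form 𝔽 d
      σ = interpolate points v
      0⃗ : Vec E (length points)
      0⃗ = Vec.replicate (length points) 0#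
      to : ∀ F → values F ≡ v → values (F ⊖ σ) ≡ 0⃗
      to F refl = trans (values-⊖ F σ) (trans (cong (values F ⊖_) (values-interpolate (values F))) (⊖-self (values F)))
      from : ∀ F → values (F ⊖ σ) ≡ 0⃗ → values F ≡ v
      from F eq = ⊖≡0⇒≡ (values F) v
        (trans (cong (values F ⊖_) (sym (values-interpolate v))) (trans (sym (values-⊖ F σ)) eq))

    ∑-values : (h : Vec E (length points) → ℕ) →
               ∑ (h ∘ values) (S 𝔽 d) ≡ kernelSize ℕ.* ∑ h (allVecs elements (length points))
    ∑-values h = begin
        ∑ (h ∘ values) (S 𝔽 d)
          ≡⟨ ∑-fibres _≟ᵥ_ (S 𝔽 d) W (vectors-isEnumeration _) values h ⟩
        ∑ (λ v → fibreSize v ℕ.* h v) W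
          ≡⟨ ∑-cong (λ v → cong (ℕ._* h v) (fibreSize≡kernelSize v)) W ⟩
        ∑ (λ v → kernelSize ℕ.* h v) W
          ≡⟨ ∑-*ˡ kernelSize h W ⟩
        kernelSize ℕ.* ∑ h W ∎
      where
      open ≡-Reasoning
      W : List (Vec E (length points))
      W = allVecs elements (length points)

module PointCounts (𝔽 : FiniteField) where

  open import Data.Nat as ℕ using (ℕ; zero; suc; _∸_; _≤_; _^_)
  import Data.Nat.Properties as ℕ
  open import Data.Fin as Fin using (Fin)
  open import Data.Integer as ℤ using (ℤ; +_)
  import Data.Integer.Properties as ℤ
  open import Data.List using (List; []; _∷_; map; length; filter)
  open import Data.Vec using (Vec; []; _∷_)
  open import Relation.Binary.PropositionalEquality

  open Counting
  open ProjectivePlane 𝔽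
  open EvaluationMap 𝔽
  open Probability

  open FiniteField 𝔽

  private
    E : Set
    E = Elt 𝔽

  zeros : {n : ℕ} → Vec E n → ℕ
  zeros []      = 0
  zeros (a ∷ v) = χ (a Fin.≟ 0#) ℕ.+ zeros v

  zeros-tabulateOn : {A : Set} (L : List A) (f : A → E) → zeros (tabulateOn L f) ≡ ∑ (λ x → χ (f x Fin.≟ 0#)) L
  zeros-tabulateOn []      f = refl
  zeros-tabulateOn (x ∷ L) f = cong (χ (f x Fin.≟ 0#) ℕ.+_) (zeros-tabulateOn L f)

  zeroCount : ℕ → ℤ → ℕ
  zeroCount n t = ∑ (λ v → χ (+ zeros v ℤ.≟ t)) (allVecs elements n)

  q≡1+[q∸1] : q ≡ suc (q ∸ 1)
  q≡1+[q∸1] = nonEmpty 0#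
    where
    nonEmpty : {n : ℕ} → Fin n → n ≡ suc (n ∸ 1)
    nonEmpty {suc n} _ = refl

  q^n>0 : ∀ n → 0 ℕ.< q ^ n
  q^n>0 n = subst (λ r → 0 ℕ.< r ^ n) (sym q≡1+[q∸1]) (ℕ.m^n>0 (suc (q ∸ 1)) n)

  zeroCount-suc : ∀ n t → zeroCount (suc n) t ≡ zeroCount n (ℤ.pred t) ℕ.+ (q ∸ 1) ℕ.* zeroCount n t
  zeroCount-suc n t = ℕ.+-cancelʳ-≡ (zeroCount n t) _ _ (begin
      zeroCount (suc n) t ℕ.+ zeroCount n t
        ≡⟨ cong (ℕ._+ g 0) (trans (∑-concatMap _ (λ x → map (x ∷_) V) elements) (∑-cong (λ x → ∑-map _ (x ∷_) V) elements)) ⟩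
      ∑ (λ x → g (χ (x Fin.≟ 0#))) elements ℕ.+ g 0
        ≡⟨ ∑-split Fin._≟_ elements (allFin-isEnumeration q) 0# g ⟩
      g 1 ℕ.+ length elements ℕ.* g 0
        ≡⟨ cong₂ (λ a m → a ℕ.+ m ℕ.* g 0) g1≡ (trans length-elements q≡1+[q∸1]) ⟩
      zeroCount n (ℤ.pred t) ℕ.+ (g 0 ℕ.+ (q ∸ 1) ℕ.* g 0)
        ≡⟨ cong (zeroCount n (ℤ.pred t) ℕ.+_) (ℕ.+-comm (g 0) _) ⟩
      zeroCount n (ℤ.pred t) ℕ.+ ((q ∸ 1) ℕ.* g 0 ℕ.+ g 0)
        ≡⟨ ℕ.+-assoc (zeroCount n (ℤ.pred t)) _ (g 0) ⟨
      zeroCount n (ℤ.pred t) ℕ.+ (q ∸ 1) ℕ.* zeroCount n t ℕ.+ zeroCount n t ∎)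
    where
    open ≡-Reasoning
    V : List (Vec E n)
    V = allVecs elements n
    g : ℕ → ℕ
    g k = ∑ (λ v → χ (+ (k ℕ.+ zeros v) ℤ.≟ t)) V
    g1≡ : g 1 ≡ zeroCount n (ℤ.pred t)
    g1≡ = ∑-cong (λ v → χ-cong +suc≡⇒+≡pred +≡pred⇒+suc≡ _ _) V

  zeroCount-zero : ∀ t → zeroCount 0 t ≡ χ (+ 0 ℤ.≟ t)
  zeroCount-zero t = ℕ.+-identityʳ _

  frac-zeroCount≡probSum : ∀ n t → frac (+ zeroCount n t) (q ^ n) ≡ probSum (frac (+ (q ∸ 1)) q) (frac (+ 1) q) n t
  frac-zeroCount≡probSum n t =
    subst (λ r → frac (+ zeroCount n t) (r ^ n) ≡ probSum (frac (+ (q ∸ 1)) r) (frac (+ 1) r) n t)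
          (sym q≡1+[q∸1])
          (sym (probSum≡frac (q ∸ 1) zeroCount zeroCount-zero zeroCount-suc n t))

  q²+q+1<d⇒2q+1≤d : {d : ℕ} → q ℕ.* q ℕ.+ q ℕ.+ 1 ℕ.< d → suc (q ℕ.+ q) ≤ d
  q²+q+1<d⇒2q+1≤d {d} q²+q+1<d = begin
      suc (q ℕ.+ q)          ≡⟨ ℕ.+-comm 1 (q ℕ.+ q) ⟩
      q ℕ.+ q ℕ.+ 1          ≤⟨ ℕ.+-monoˡ-≤ 1 (ℕ.+-monoˡ-≤ q q≤q*q) ⟩
      q ℕ.* q ℕ.+ q ℕ.+ 1    <⟨ q²+q+1<d ⟩
      d                      ∎
    where
    open ℕ.≤-Reasoning
    q≤q*q : q ≤ q ℕ.* q
    q≤q*q = subst (λ r → r ≤ r ℕ.* r) (sym q≡1+[q∸1]) (ℕ.m≤m*n (suc (q ∸ 1)) (suc (q ∸ 1)))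

  module _ (d : ℕ) (2q+1≤d : suc (q ℕ.+ q) ≤ d) where

    #C≡zeros∘values : (F : Form 𝔽 d) → #C 𝔽 d F ≡ zeros (values d 2q+1≤d F)
    #C≡zeros∘values F = begin
        length (filter (λ P → eval 𝔽 {d} F P Fin.≟ 0#) (P2 𝔽))
          ≡⟨ cong (λ Ps → length (filter (λ P → eval 𝔽 {d} F P Fin.≟ 0#) Ps)) P2≡map-coords ⟩
        length (filter (λ P → eval 𝔽 {d} F P Fin.≟ 0#) (map coords points))
          ≡⟨ length-filter≡∑χ (λ P → eval 𝔽 {d} F P Fin.≟ 0#) (map coords points) ⟩
        ∑ (λ P → χ (eval 𝔽 {d} F P Fin.≟ 0#)) (map coords points)
          ≡⟨ ∑-map _ coords points ⟩
        ∑ (λ u → χ (evalAt d 2q+1≤d F u Fin.≟ 0#)) points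
          ≡⟨ zeros-tabulateOn points (evalAt d 2q+1≤d F) ⟨
        zeros (values d 2q+1≤d F) ∎
      where open ≡-Reasoning

    countWith≡kernelSize*zeroCount : (t : ℤ) → countWith 𝔽 d t ≡ kernelSize d 2q+1≤d ℕ.* zeroCount (length points) t
    countWith≡kernelSize*zeroCount t = begin
        countWith 𝔽 d t
          ≡⟨ length-filter≡∑χ (λ F → + #C 𝔽 d F ℤ.≟ t) (S 𝔽 d) ⟩
        ∑ (λ F → χ (+ #C 𝔽 d F ℤ.≟ t)) (S 𝔽 d)
          ≡⟨ ∑-cong (λ F → cong (λ k → χ (+ k ℤ.≟ t)) (#C≡zeros∘values F)) (S 𝔽 d) ⟩
        ∑ (λ F → χ (+ zeros (values d 2q+1≤d F) ℤ.≟ t)) (S 𝔽 d)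
          ≡⟨ ∑-values d 2q+1≤d (λ v → χ (+ zeros v ℤ.≟ t)) ⟩
        kernelSize d 2q+1≤d ℕ.* zeroCount (length points) t ∎
      where open ≡-Reasoning

    #S≡kernelSize*q^#points : #S 𝔽 d ≡ kernelSize d 2q+1≤d ℕ.* q ^ length points
    #S≡kernelSize*q^#points = begin
        length (S 𝔽 d)                                   ≡⟨ ℕ.*-identityʳ _ ⟨
        length (S 𝔽 d) ℕ.* 1                             ≡⟨ ∑-const 1 (S 𝔽 d) ⟨
        ∑ (λ _ → 1) (S 𝔽 d)                              ≡⟨ ∑-values d 2q+1≤d (λ _ → 1) ⟩
        kernelSize d 2q+1≤d ℕ.* ∑ (λ _ → 1) W            ≡⟨ cong (kernelSize d 2q+1≤d ℕ.*_) (trans (∑-const 1 W) (ℕ.*-identityʳ _)) ⟩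
        kernelSize d 2q+1≤d ℕ.* length W                 ≡⟨ cong (kernelSize d 2q+1≤d ℕ.*_) (length-vectors (length points)) ⟩
        kernelSize d 2q+1≤d ℕ.* q ^ length points        ∎
      where
      open ≡-Reasoning
      W : List (Vec E (length points))
      W = allVecs elements (length points)

    kernelSize>0 : 0 ℕ.< kernelSize d 2q+1≤d
    kernelSize>0 = ℕ.n≢0⇒n>0 λ K≡0 → ℕ.<⇒≢ (q^n>0 (length (monomials d))) (begin
        0                                             ≡⟨ cong (ℕ._* q ^ length points) K≡0 ⟨
        kernelSize d 2q+1≤d ℕ.* q ^ length points     ≡⟨ #S≡kernelSize*q^#points ⟨
        length (S 𝔽 d)                                ≡⟨ length-vectors (length (monomials d)) ⟩
        q ^ length (monomials d)                      ∎)
      where open ≡-Reasoning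

open import Data.Nat using (ℕ; _<_; _*_; _+_; _∸_; suc; _≤_; _^_)
open import Data.Integer using (ℤ; +_)
open import Relation.Binary.PropositionalEquality using (_≡_; cong; cong₂; module ≡-Reasoning)
open import Data.List using (length)
open Probability using (frac-cancelˡ)

proposition1 : (𝔽 : FiniteField) → let q = FiniteField.q 𝔽 in
    (d : ℕ) → q * q + q + 1 < d → (t : ℤ) →
    frac (+ countWith 𝔽 d t) (#S 𝔽 d)
    ≡ probSum (frac (+ (q ∸ 1)) q) (frac (+ 1) q) (q * q + q + 1) t
proposition1 𝔽 d q²+q+1<d t = begin
    frac (+ countWith 𝔽 d t) (#S 𝔽 d)
      ≡⟨ cong₂ (λ a b → frac (+ a) b) (countWith≡kernelSize*zeroCount d 2q+1≤d t)
                                      (#S≡kernelSize*q^#points d 2q+1≤d) ⟩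
    frac (+ (K * zeroCount N t)) (K * q ^ N)
      ≡⟨ frac-cancelˡ K (zeroCount N t) (q ^ N) (kernelSize>0 d 2q+1≤d) (q^n>0 N) ⟩
    frac (+ zeroCount N t) (q ^ N)
      ≡⟨ frac-zeroCount≡probSum N t ⟩
    probSum (frac (+ (q ∸ 1)) q) (frac (+ 1) q) N t
      ≡⟨ cong (λ n → probSum (frac (+ (q ∸ 1)) q) (frac (+ 1) q) n t) length-points ⟩
    probSum (frac (+ (q ∸ 1)) q) (frac (+ 1) q) (q * q + q + 1) t ∎
  where
  open ≡-Reasoning
  open FiniteField 𝔽 using (q)
  open ProjectivePlane 𝔽 using (points; length-points)
  open PointCounts 𝔽
  2q+1≤d : suc (q + q) ≤ d
  2q+1≤d = q²+q+1<d⇒2q+1≤d q²+q+1<d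
  N K : ℕ
  N = length points
  K = EvaluationMap.kernelSize 𝔽 d 2q+1≤d
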